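{- Let $D\geq 1$ be an integer and define $$F_{1,D}(x_1,\ldots,x_D):=\det\left(\frac{B_n(x_k)}{n}\right)_{1\leq n\leq D,\ 1\leq k\leq D}\in\mathbb Q[x_1,\ldots,x_D]$$ (row index $n$, column index $k$), where $B_n(x)$ is the $n$-th Bernoulli polynomial. Then: (1) there exists a symmetric polynomial $G_{1,D}\in\mathbb Q[x_1,\ldots,x_D]$ of degree $D$ such that $$F_{1,D}(x_1,\ldots,x_D)=\prod_{1\leq i<j\leq D}(x_j-x_i)\cdot G_{1,D}(x_1,\ldots,x_D);$$ (2) $G_{1,D}(x_1,\ldots,x_D)=\frac{1}{D!}x_1x_2\cdots x_D+\text{(terms of lower degree)}$; (3) $G_{1,D}(0,\ldots,0)=\frac{(-1)^D}{(D+1)!}$.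
   Context: The Bernoulli polynomials $B_n(x)$ are defined by $\frac{z e^{xz}}{e^z-1}=\sum_{n\geq 0}B_n(x)\frac{z^n}{n!}$; equivalently $B_n(x)=\sum_{k=0}^n\binom{n}{k}B_{n-k}x^k$, where the Bernoulli numbers $B_j$ are defined by $\frac{z}{e^z-1}=\sum_{j\geq 0}B_j\frac{z^j}{j!}$. -}

module Defs where

open import Data.Nat as ℕ using (ℕ; zero; suc; _!)
open import Data.Nat.Properties using (_!≢0)
open import Data.Nat.Combinatorics using (_C_)
open import Data.Integer as ℤ using (ℤ; +_; -[1+_])
open import Data.Rational as ℚ using (ℚ; 0ℚ; 1ℚ; _+_; _*_; -_; _-_; _/_)
open import Data.Fin as Fin using (Fin; toℕ; punchIn)
open import Data.Vec as Vec using (Vec; []; _∷_; lookup; tabulate)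
open import Data.Vec.Properties using (≡-dec)
open import Data.List as List using (List; []; _∷_; _∷ʳ_)
open import Data.Product using (_×_; _,_)
open import Data.Bool using (if_then_else_)
open import Relation.Nullary using (yes; no)

Σ< : ℕ → (ℕ → ℚ) → ℚ
Σ< zero    f = 0ℚ
Σ< (suc n) f = Σ< n f + f n

sumFin : (n : ℕ) → (Fin n → ℚ) → ℚ
sumFin zero    f = 0ℚ
sumFin (suc n) f = f Fin.zero + sumFin n (λ i → f (Fin.suc i))

prodFin : (n : ℕ) → (Fin n → ℚ) → ℚ
prodFin zero    f = 1ℚ
prodFin (suc n) f = f Fin.zero * prodFin n (λ i → f (Fin.suc i))

_^ℚ_ : ℚ → ℕ → ℚ
x ^ℚ zero    = 1ℚ
x ^ℚ (suc n) = x * (x ^ℚ n)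

ℕ→ℚ : ℕ → ℚ
ℕ→ℚ n = + n / 1

inv! : ℕ → ℚ
inv! n = (+ 1 / (n !)) {{n !≢0}}

-- Bernoulli numbers, defined by z/(e^z-1) = Σ B_j z^j/j!.
-- Comparing coefficients of z^m in ((e^z-1)/z) · Σ B_j z^j/j! = 1 gives
-- B_0 = 1 and Σ_{k=0}^{m} C(m+1,k) B_k = 0 for m ≥ 1, i.e.
-- B_m = -(1/(m+1)) Σ_{k<m} C(m+1,k) B_k.

nth : List ℚ → ℕ → ℚ
nth []       _       = 0ℚ
nth (x ∷ xs) zero    = x
nth (x ∷ xs) (suc k) = nth xs k

bernList : ℕ → List ℚ
bernList zero    = 1ℚ ∷ []
bernList (suc m) = bs ∷ʳ next
  where
  bs : List ℚ
  bs = bernList m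
  next : ℚ
  next = - ((+ 1 / suc (suc m)) * Σ< (suc m) (λ k → ℕ→ℚ (suc (suc m) C k) * nth bs k))

bernoulli : ℕ → ℚ
bernoulli n = nth (bernList n) n

bernoulliPoly : ℕ → ℚ → ℚ
bernoulliPoly n x = Σ< (suc n) (λ k → ℕ→ℚ (n C k) * bernoulli (n ℕ.∸ k) * (x ^ℚ k))

-- Determinant of an n×n rational matrix (Laplace expansion along the
-- first row; equal to the Leibniz formula).

sign : ℕ → ℚ
sign zero          = 1ℚ
sign (suc zero)    = - 1ℚ
sign (suc (suc k)) = sign k

det : (n : ℕ) → (Fin n → Fin n → ℚ) → ℚ
det zero    A = 1ℚ
det (suc n) A = sumFin (suc n) λ j →
  sign (toℕ j) * A Fin.zero j * det n (λ r c → A (Fin.suc r) (punchIn j c))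

-- F_{1,D}(x_1,…,x_D) = det (B_n(x_k)/n), rows n = 1..D, columns k = 1..D.
-- Row index i : Fin D corresponds to n = toℕ i + 1.

F1 : (D : ℕ) → (Fin D → ℚ) → ℚ
F1 D x = det D (λ i k → bernoulliPoly (suc (toℕ i)) (x k) * (+ 1 / suc (toℕ i)))

vandermonde : (D : ℕ) → (Fin D → ℚ) → ℚ
vandermonde D x = prodFin D λ j → prodFin D λ i →
  if toℕ i ℕ.<ᵇ toℕ j then x j - x i else 1ℚ

-- Polynomials in D variables over ℚ: finite formal sums of terms
-- c · x^e, with e : Vec ℕ D an exponent vector.  The polynomial itself is
-- determined by its coefficient function `coeff`.

Monomial : ℕ → Set
Monomial D = Vec ℕ D

Poly : ℕ → Set
Poly D = List (ℚ × Monomial D)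

coeff : ∀ {D} → Poly D → Monomial D → ℚ
coeff []             e = 0ℚ
coeff ((c , m) ∷ ps) e with ≡-dec ℕ._≟_ m e
... | yes _ = c + coeff ps e
... | no  _ = coeff ps e

evalMono : ∀ {D} → Monomial D → (Fin D → ℚ) → ℚ
evalMono {D} e x = prodFin D (λ i → x i ^ℚ lookup e i)

eval : ∀ {D} → Poly D → (Fin D → ℚ) → ℚ
eval []             x = 0ℚ
eval ((c , m) ∷ ps) x = c * evalMono m x + eval ps x

totalDeg : ∀ {D} → Monomial D → ℕ
totalDeg []       = 0
totalDeg (k ∷ ks) = k ℕ.+ totalDeg ks

open import Data.Fin.Permutation using (Permutation′; _⟨$⟩ʳ_)

permuteMono : ∀ {D} → Permutation′ D → Monomial D → Monomial D
permuteMono σ e = tabulate (λ i → lookup e (σ ⟨$⟩ʳ i))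

open import Relation.Binary.PropositionalEquality using (_≡_; _≢_)
open import Data.Product using (∃-syntax)

IsSymmetric : ∀ {D} → Poly D → Set
IsSymmetric {D} p = (σ : Permutation′ D) (e : Monomial D) →
  coeff p (permuteMono σ e) ≡ coeff p e

HasDegree : ∀ {D} → Poly D → ℕ → Set
HasDegree {D} p d =
  ((e : Monomial D) → coeff p e ≢ 0ℚ → totalDeg e ℕ.≤ d) ×
  (∃[ e ] (totalDeg e ≡ d × coeff p e ≢ 0ℚ))

HasLeadingPart : ∀ {D} → Poly D → ℚ → Set
HasLeadingPart {D} p c =
  (coeff p (Vec.replicate D 1) ≡ c) ×
  ((e : Monomial D) → e ≢ Vec.replicate D 1 → D ℕ.≤ totalDeg e → coeff p e ≡ 0ℚ)

{-# OPTIONS --safe #-}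
module Submission where

-- Since B_n(x) = Σ_j C(n,j) B_{n-j} xʲ, the matrix with rows (∫₀¹ B_n, B_n(x_1), …, B_n(x_D)),
-- n = 0, …, D, is L · M for the unitriangular L = (C(n,j) B_{n-j}) and M = (1/(n+1), x_1ⁿ, …, x_Dⁿ).
-- Its first column is (1, 0, …, 0), so det (B_n(x_k))_{1≤n,k≤D} = det M. Subtracting x_1 times each
-- row of M from the next one and expanding along the column of x_1 gives, by induction on D,
-- det M = Π_{i<j} (x_j - x_i) · Σ_m (-1)ᵐ e_{D-m}(x) / (m+1). With the factor 1/D! from the entries
-- B_n(x_k)/n this yields G = (1/D!) Σ_m (-1)ᵐ e_{D-m}(x) / (m+1): symmetric, with top-degree part
-- x_1⋯x_D / D! (from m = 0) and constant term (-1)ᴰ / (D+1)! (from m = D).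

open import Defs
open import Data.Nat as ℕ using (ℕ; zero; suc; _≤_; _<_; z≤n; s≤s; _∸_; _!)
import Data.Nat.Properties as ℕₚ
open import Data.Nat.Properties using (_!≢0)
open import Data.Nat.Combinatorics using (_C_; nCk≡nC[n∸k]; nCn≡1; nC1≡n; k>n⇒nCk≡0; nCk+nC[k+1]≡[n+1]C[k+1])
import Data.Nat.Tactic.RingSolver as ℕ-RingSolver
import Data.Integer as ℤ
import Data.Integer.Properties as ℤₚ
open import Data.Rational as ℚ using (ℚ; 0ℚ; 1ℚ; _+_; _*_; -_; _-_; _/_)
import Data.Rational.Properties as ℚₚ
import Data.Rational.Unnormalised as ℚᵘ
import Data.Rational.Unnormalised.Properties as ℚᵘₚ
open import Data.Fin as Fin using (Fin; zero; suc; toℕ; punchIn; punchOut; inject₁; fromℕ<)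
import Data.Fin.Properties as Finₚ
open import Data.Fin.Permutation using (Permutation′; _⟨$⟩ʳ_)
open import Data.Vec as Vec using ([]; _∷_; lookup; tabulate)
import Data.Vec.Properties as Vecₚ
open import Data.Vec.Functional using (updateAt)
open import Data.Vec.Functional.Properties using (updateAt-updates; updateAt-minimal)
open import Data.List as List using ([]; _∷_; _++_; _∷ʳ_; length)
import Data.List.Properties as Listₚ
open import Algebra.Properties.CommutativeMonoid.Sum ℕₚ.+-0-commutativeMonoid using (sum; sum-permute; sum-cong-≗)
open import Data.Bool using (if_then_else_)
open import Data.Product using (_×_; _,_; ∃-syntax)
open import Data.Sum using (inj₁; inj₂)
open import Data.Empty using (⊥-elim)
open import Function using (_∘_; id)
open import Relation.Nullary using (Dec; yes; no)
open import Relation.Binary.PropositionalEquality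
open import Data.Rational.Solver using (module +-*-Solver)
open +-*-Solver using (solve; _:+_; _:*_; :-_; _:-_; _:=_; con)
open ≡-Reasoning

x≡-x⇒x≡0 : ∀ x → x ≡ - x → x ≡ 0ℚ
x≡-x⇒x≡0 x x≡-x = begin
  x              ≡⟨ halve x ⟩
  ½ * (x + x)    ≡⟨ cong (λ y → ½ * (x + y)) x≡-x ⟩
  ½ * (x - x)    ≡⟨ cong (½ *_) (ℚₚ.+-inverseʳ x) ⟩
  ½ * 0ℚ         ≡⟨ ℚₚ.*-zeroʳ ½ ⟩
  0ℚ             ∎
  where
  ½ : ℚ
  ½ = ℤ.+ 1 / 2
  halve : ∀ x → x ≡ ½ * (x + x)
  halve = solve 1 (λ x → x := con ½ :* (x :+ x)) refl

sign-suc : ∀ k → sign (suc k) ≡ - sign k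
sign-suc zero    = refl
sign-suc (suc k) = begin
  sign k             ≡⟨ neg-involutive (sign k) ⟨
  - (- sign k)       ≡⟨ cong -_ (sign-suc k) ⟨
  - sign (suc k)     ∎
  where
  neg-involutive : ∀ x → - (- x) ≡ x
  neg-involutive = solve 1 (λ x → :- (:- x) := x) refl

/-cross : ∀ a b c d .{{_ : ℕ.NonZero b}} .{{_ : ℕ.NonZero d}} → a ℕ.* d ≡ c ℕ.* b → ℤ.+ a / b ≡ ℤ.+ c / d
/-cross a (suc b) c (suc d) ad≡cb =
  ℚₚ.fromℚᵘ-cong {ℚᵘ.mkℚᵘ (ℤ.+ a) b} {ℚᵘ.mkℚᵘ (ℤ.+ c) d} (ℚᵘ.*≡* (begin
  ℤ.+ a ℤ.* ℤ.+ suc d   ≡⟨ ℤₚ.pos-* a (suc d) ⟨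
  ℤ.+ (a ℕ.* suc d)     ≡⟨ cong ℤ.+_ ad≡cb ⟩
  ℤ.+ (c ℕ.* suc b)     ≡⟨ ℤₚ.pos-* c (suc b) ⟩
  ℤ.+ c ℤ.* ℤ.+ suc b   ∎))

/-* : ∀ a b c d .{{_ : ℕ.NonZero b}} .{{_ : ℕ.NonZero d}} →
      (ℤ.+ a / b) * (ℤ.+ c / d) ≡ (ℤ.+ (a ℕ.* c) / (b ℕ.* d)) {{ℕₚ.m*n≢0 b d}}
/-* a (suc b) c (suc d) = ℚₚ.toℚᵘ-injective (
  ℚᵘₚ.≃-trans (ℚₚ.toℚᵘ-homo-* (ℤ.+ a / suc b) (ℤ.+ c / suc d)) (
  ℚᵘₚ.≃-trans (ℚᵘₚ.*-cong (ℚₚ.toℚᵘ-fromℚᵘ (ℚᵘ.mkℚᵘ (ℤ.+ a) b)) (ℚₚ.toℚᵘ-fromℚᵘ (ℚᵘ.mkℚᵘ (ℤ.+ c) d))) (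
  ℚᵘₚ.≃-trans (ℚᵘₚ.≃-reflexive (cong (λ n → ℚᵘ.mkℚᵘ n bd-1) (sym (ℤₚ.pos-* a c))))
              (ℚᵘₚ.≃-sym (ℚₚ.toℚᵘ-fromℚᵘ (ℚᵘ.mkℚᵘ (ℤ.+ (a ℕ.* c)) bd-1))))))
  where bd-1 = ℕ.pred (suc b ℕ.* suc d)

ℕ→ℚ-*-inverse : ∀ n → ℕ→ℚ (suc n) * (ℤ.+ 1 / suc n) ≡ 1ℚ
ℕ→ℚ-*-inverse n = trans (/-* (suc n) 1 1 (suc n)) (/-cross (suc n ℕ.* 1) (1 ℕ.* suc n) 1 1 (cross (suc n)))
  where
  cross : ∀ m → m ℕ.* 1 ℕ.* 1 ≡ 1 ℕ.* (1 ℕ.* m)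
  cross = ℕ-RingSolver.solve-∀

inv!-suc : ∀ n → inv! n * (ℤ.+ 1 / suc n) ≡ inv! (suc n)
inv!-suc n = trans (/-* 1 (n !) 1 (suc n) {{n !≢0}})
                   (/-cross (1 ℕ.* 1) (n ! ℕ.* suc n) 1 (suc n !) {{ℕₚ.m*n≢0 (n !) (suc n) {{n !≢0}}}} {{suc n !≢0}}
                            (cross (n !) (suc n)))
  where
  cross : ∀ f m → 1 ℕ.* 1 ℕ.* (m ℕ.* f) ≡ 1 ℕ.* (f ℕ.* m)
  cross = ℕ-RingSolver.solve-∀

inv!≢0 : ∀ n → inv! n ≢ 0ℚ
inv!≢0 n inv!≡0 = ℚₚ.<⇒≢ (ℚₚ.positive⁻¹ (inv! n) {{ℚₚ.normalize-pos 1 (n !) {{n !≢0}}}}) (sym inv!≡0)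

sumFin-cong : ∀ n {f g : Fin n → ℚ} → f ≗ g → sumFin n f ≡ sumFin n g
sumFin-cong zero    f≗g = refl
sumFin-cong (suc n) f≗g = cong₂ _+_ (f≗g zero) (sumFin-cong n (f≗g ∘ suc))

sumFin-zero : ∀ n {f : Fin n → ℚ} → (∀ i → f i ≡ 0ℚ) → sumFin n f ≡ 0ℚ
sumFin-zero zero    f≡0 = refl
sumFin-zero (suc n) f≡0 = cong₂ _+_ (f≡0 zero) (sumFin-zero n (f≡0 ∘ suc))

sumFin-+ : ∀ n (f g : Fin n → ℚ) →
           sumFin n (λ i → f i + g i) ≡ sumFin n f + sumFin n g
sumFin-+ zero    f g = refl
sumFin-+ (suc n) f g = begin
  (f zero + g zero) + sumFin n (λ i → f (suc i) + g (suc i))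
    ≡⟨ cong (f zero + g zero +_) (sumFin-+ n (f ∘ suc) (g ∘ suc)) ⟩
  (f zero + g zero) + (sumFin n (f ∘ suc) + sumFin n (g ∘ suc))
    ≡⟨ interchange (f zero) (g zero) _ _ ⟩
  (f zero + sumFin n (f ∘ suc)) + (g zero + sumFin n (g ∘ suc)) ∎
  where
  interchange : ∀ a b c d → (a + b) + (c + d) ≡ (a + c) + (b + d)
  interchange = solve 4 (λ a b c d → (a :+ b) :+ (c :+ d) := (a :+ c) :+ (b :+ d)) refl

sumFin-*ˡ : ∀ n (c : ℚ) (f : Fin n → ℚ) → sumFin n (λ i → c * f i) ≡ c * sumFin n f
sumFin-*ˡ zero    c f = sym (ℚₚ.*-zeroʳ c)
sumFin-*ˡ (suc n) c f = begin
  c * f zero + sumFin n (λ i → c * f (suc i)) ≡⟨ cong (c * f zero +_) (sumFin-*ˡ n c (f ∘ suc)) ⟩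
  c * f zero + c * sumFin n (f ∘ suc)         ≡⟨ ℚₚ.*-distribˡ-+ c (f zero) _ ⟨
  c * (f zero + sumFin n (f ∘ suc))           ∎

sumFin-neg : ∀ n (f : Fin n → ℚ) → sumFin n (λ i → - f i) ≡ - sumFin n f
sumFin-neg zero    f = refl
sumFin-neg (suc n) f = begin
  - f zero + sumFin n (λ i → - f (suc i)) ≡⟨ cong (- f zero +_) (sumFin-neg n (f ∘ suc)) ⟩
  - f zero + - sumFin n (f ∘ suc)         ≡⟨ ℚₚ.neg-distrib-+ (f zero) _ ⟨
  - (f zero + sumFin n (f ∘ suc))         ∎

sumFin-comm : ∀ m n (f : Fin m → Fin n → ℚ) →
              sumFin m (λ i → sumFin n (f i)) ≡ sumFin n (λ j → sumFin m (λ i → f i j))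
sumFin-comm zero    n f = sym (sumFin-zero n (λ _ → refl))
sumFin-comm (suc m) n f = begin
  sumFin n (f zero) + sumFin m (λ i → sumFin n (f (suc i)))
    ≡⟨ cong (sumFin n (f zero) +_) (sumFin-comm m n (f ∘ suc)) ⟩
  sumFin n (f zero) + sumFin n (λ j → sumFin m (λ i → f (suc i) j))
    ≡⟨ sumFin-+ n (f zero) _ ⟨
  sumFin n (λ j → sumFin (suc m) (λ i → f i j)) ∎

sumFin-single : ∀ n {f : Fin n → ℚ} (k : Fin n) → (∀ j → j ≢ k → f j ≡ 0ℚ) →
                sumFin n f ≡ f k
sumFin-single (suc n) {f} zero    f≡0 = begin
  f zero + sumFin n (f ∘ suc) ≡⟨ cong (f zero +_) (sumFin-zero n (λ j → f≡0 (suc j) λ ())) ⟩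
  f zero + 0ℚ                 ≡⟨ ℚₚ.+-identityʳ (f zero) ⟩
  f zero                      ∎
sumFin-single (suc n) {f} (suc k) f≡0 = begin
  f zero + sumFin n (f ∘ suc) ≡⟨ cong₂ _+_ (f≡0 zero λ ())
                                          (sumFin-single n k (λ j j≢k → f≡0 (suc j) (j≢k ∘ Finₚ.suc-injective))) ⟩
  0ℚ + f (suc k)              ≡⟨ ℚₚ.+-identityˡ (f (suc k)) ⟩
  f (suc k)                   ∎


sumFin-punchIn : ∀ n (j : Fin (suc n)) {f : Fin (suc n) → ℚ} → f j ≡ 0ℚ →
                 sumFin (suc n) f ≡ sumFin n (f ∘ punchIn j)
sumFin-punchIn n       zero    {f} fj≡0 = trans (cong (_+ sumFin n (f ∘ suc)) fj≡0) (ℚₚ.+-identityˡ _)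
sumFin-punchIn (suc n) (suc j) {f} fj≡0 = cong (f zero +_) (sumFin-punchIn n j {f ∘ suc} fj≡0)

prodFin-one : ∀ n {f : Fin n → ℚ} → (∀ i → f i ≡ 1ℚ) → prodFin n f ≡ 1ℚ
prodFin-one zero    f≡1 = refl
prodFin-one (suc n) f≡1 = cong₂ _*_ (f≡1 zero) (prodFin-one n (f≡1 ∘ suc))

prodFin-* : ∀ n (f g : Fin n → ℚ) → prodFin n (λ i → f i * g i) ≡ prodFin n f * prodFin n g
prodFin-* zero    f g = refl
prodFin-* (suc n) f g = begin
  (f zero * g zero) * prodFin n (λ i → f (suc i) * g (suc i))
    ≡⟨ cong (f zero * g zero *_) (prodFin-* n (f ∘ suc) (g ∘ suc)) ⟩
  (f zero * g zero) * (prodFin n (f ∘ suc) * prodFin n (g ∘ suc))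
    ≡⟨ interchange (f zero) (g zero) _ _ ⟩
  (f zero * prodFin n (f ∘ suc)) * (g zero * prodFin n (g ∘ suc)) ∎
  where
  interchange : ∀ a b c d → (a * b) * (c * d) ≡ (a * c) * (b * d)
  interchange = solve 4 (λ a b c d → (a :* b) :* (c :* d) := (a :* c) :* (b :* d)) refl

prodFin-snoc : ∀ n (g : ℕ → ℚ) → prodFin (suc n) (g ∘ toℕ) ≡ prodFin n (g ∘ toℕ) * g n
prodFin-snoc zero    g = trans (ℚₚ.*-identityʳ (g 0)) (sym (ℚₚ.*-identityˡ (g 0)))
prodFin-snoc (suc n) g = trans (cong (g 0 *_) (prodFin-snoc n (g ∘ suc))) (sym (ℚₚ.*-assoc (g 0) _ (g (suc n))))

prodFin-punchIn : ∀ n (j : Fin (suc n)) (f : Fin (suc n) → ℚ) →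
                  prodFin (suc n) f ≡ f j * prodFin n (f ∘ punchIn j)
prodFin-punchIn n       zero    f = refl
prodFin-punchIn (suc n) (suc j) f = begin
  f zero * prodFin (suc n) (f ∘ suc)                     ≡⟨ cong (f zero *_) (prodFin-punchIn n j (f ∘ suc)) ⟩
  f zero * (f (suc j) * prodFin n (f ∘ suc ∘ punchIn j)) ≡⟨ left-comm (f zero) (f (suc j)) _ ⟩
  f (suc j) * (f zero * prodFin n (f ∘ suc ∘ punchIn j)) ∎
  where
  left-comm : ∀ a b c → a * (b * c) ≡ b * (a * c)
  left-comm = solve 3 (λ a b c → a :* (b :* c) := b :* (a :* c)) refl

Σ<-cong : ∀ n {f g : ℕ → ℚ} → (∀ k → k < n → f k ≡ g k) → Σ< n f ≡ Σ< n g
Σ<-cong zero    f≡g = refl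
Σ<-cong (suc n) f≡g = cong₂ _+_ (Σ<-cong n (λ k k<n → f≡g k (ℕₚ.m<n⇒m<1+n k<n))) (f≡g n ℕₚ.≤-refl)

Σ<-head : ∀ n (f : ℕ → ℚ) → Σ< (suc n) f ≡ f 0 + Σ< n (f ∘ suc)
Σ<-head zero    f = trans (ℚₚ.+-identityˡ (f 0)) (sym (ℚₚ.+-identityʳ (f 0)))
Σ<-head (suc n) f = begin
  Σ< (suc n) f + f (suc n)            ≡⟨ cong (_+ f (suc n)) (Σ<-head n f) ⟩
  (f 0 + Σ< n (f ∘ suc)) + f (suc n)  ≡⟨ ℚₚ.+-assoc (f 0) _ _ ⟩
  f 0 + Σ< (suc n) (f ∘ suc)          ∎

Σ<≡sumFin : ∀ n (f : ℕ → ℚ) → Σ< n f ≡ sumFin n (f ∘ toℕ)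
Σ<≡sumFin zero    f = refl
Σ<≡sumFin (suc n) f = trans (Σ<-head n f) (cong (f 0 +_) (Σ<≡sumFin n (f ∘ suc)))

Σ<-vanishing : ∀ n d (f : ℕ → ℚ) → (∀ k → n ≤ k → f k ≡ 0ℚ) → Σ< (d ℕ.+ n) f ≡ Σ< n f
Σ<-vanishing n zero    f f≡0 = refl
Σ<-vanishing n (suc d) f f≡0 = begin
  Σ< (d ℕ.+ n) f + f (d ℕ.+ n) ≡⟨ cong₂ _+_ (Σ<-vanishing n d f f≡0) (f≡0 _ (ℕₚ.m≤n+m n d)) ⟩
  Σ< n f + 0ℚ                  ≡⟨ ℚₚ.+-identityʳ _ ⟩
  Σ< n f                       ∎

Σ<-*ˡ : ∀ n (c : ℚ) (f : ℕ → ℚ) → Σ< n (λ k → c * f k) ≡ c * Σ< n f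
Σ<-*ˡ zero    c f = sym (ℚₚ.*-zeroʳ c)
Σ<-*ˡ (suc n) c f = trans (cong (_+ c * f n) (Σ<-*ˡ n c f)) (sym (ℚₚ.*-distribˡ-+ c (Σ< n f) (f n)))

Σ<-reverse : ∀ n (f : ℕ → ℚ) → Σ< (suc n) f ≡ Σ< (suc n) (λ k → f (n ∸ k))
Σ<-reverse zero    f = refl
Σ<-reverse (suc n) f = begin
  Σ< (suc n) f + f (suc n)                       ≡⟨ cong (_+ f (suc n)) (Σ<-reverse n f) ⟩
  Σ< (suc n) (λ k → f (n ∸ k)) + f (suc n)       ≡⟨ ℚₚ.+-comm _ (f (suc n)) ⟩
  f (suc n) + Σ< (suc n) (λ k → f (n ∸ k))       ≡⟨ Σ<-head (suc n) (λ k → f (suc n ∸ k)) ⟨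
  Σ< (suc (suc n)) (λ k → f (suc n ∸ k))         ∎

Matrix : ℕ → Set
Matrix n = Fin n → Fin n → ℚ

minor : ∀ {n} → Matrix (suc n) → Fin (suc n) → Matrix n
minor A j r c = A (suc r) (punchIn j c)

laplaceTerm : ∀ {n} → Matrix (suc n) → Fin (suc n) → ℚ
laplaceTerm {n} A j = sign (toℕ j) * A zero j * det n (minor A j)

AgreeOffRow : ∀ {n} → Fin n → Matrix n → Matrix n → Set
AgreeOffRow p A B = ∀ r → r ≢ p → ∀ c → A r c ≡ B r c

det-cong : ∀ n {A B : Matrix n} → (∀ r c → A r c ≡ B r c) → det n A ≡ det n B
det-cong zero    A≡B = refl
det-cong (suc n) A≡B = sumFin-cong (suc n) λ j →
  cong₂ (λ a d → sign (toℕ j) * a * d) (A≡B zero j) (det-cong n (λ r c → A≡B (suc r) (punchIn j c)))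

det-vanishingMinors : ∀ n (A : Matrix (suc n)) → (∀ j → det n (minor A j) ≡ 0ℚ) → det (suc n) A ≡ 0ℚ
det-vanishingMinors n A minor≡0 = sumFin-zero (suc n) λ j →
  trans (cong (sign (toℕ j) * A zero j *_) (minor≡0 j)) (ℚₚ.*-zeroʳ (sign (toℕ j) * A zero j))

sumFin-linear : ∀ n {f g h : Fin n → ℚ} (α β : ℚ) → (∀ j → f j ≡ α * g j + β * h j) →
                sumFin n f ≡ α * sumFin n g + β * sumFin n h
sumFin-linear n {f} {g} {h} α β f≡ = begin
  sumFin n f                                            ≡⟨ sumFin-cong n f≡ ⟩
  sumFin n (λ j → α * g j + β * h j)                    ≡⟨ sumFin-+ n _ _ ⟩
  sumFin n (λ j → α * g j) + sumFin n (λ j → β * h j)   ≡⟨ cong₂ _+_ (sumFin-*ˡ n α g) (sumFin-*ˡ n β h) ⟩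
  α * sumFin n g + β * sumFin n h                       ∎

det-linearInRow : ∀ n (A B₁ B₂ : Matrix n) (p : Fin n) (α β : ℚ) →
                  AgreeOffRow p A B₁ → AgreeOffRow p A B₂ →
                  (∀ c → A p c ≡ α * B₁ p c + β * B₂ p c) →
                  det n A ≡ α * det n B₁ + β * det n B₂
det-linearInRow (suc n) A B₁ B₂ zero α β A≈B₁ A≈B₂ Ap≡ = sumFin-linear (suc n) α β λ j → begin
  laplaceTerm A j
    ≡⟨ cong₂ (λ a d → sign (toℕ j) * a * d) (Ap≡ j) (det-cong n (λ r c → A≈B₁ (suc r) (λ ()) _)) ⟩
  sign (toℕ j) * (α * B₁ zero j + β * B₂ zero j) * det n (minor B₁ j)
    ≡⟨ distribute (sign (toℕ j)) α β (B₁ zero j) (B₂ zero j) _ ⟩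
  α * (sign (toℕ j) * B₁ zero j * det n (minor B₁ j)) + β * (sign (toℕ j) * B₂ zero j * det n (minor B₁ j))
    ≡⟨ cong (λ d → α * _ + β * (sign (toℕ j) * B₂ zero j * d))
            (det-cong n (λ r c → trans (sym (A≈B₁ (suc r) (λ ()) _)) (A≈B₂ (suc r) (λ ()) _))) ⟩
  α * laplaceTerm B₁ j + β * laplaceTerm B₂ j ∎
  where
  distribute : ∀ s α β b c d → s * (α * b + β * c) * d ≡ α * (s * b * d) + β * (s * c * d)
  distribute = solve 6 (λ s α β b c d →
    s :* (α :* b :+ β :* c) :* d := α :* (s :* b :* d) :+ β :* (s :* c :* d)) refl
det-linearInRow (suc n) A B₁ B₂ (suc p) α β A≈B₁ A≈B₂ Ap≡ = sumFin-linear (suc n) α β λ j → begin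
  laplaceTerm A j
    ≡⟨ cong₂ (λ a d → sign (toℕ j) * a * d) (A≈B₁ zero (λ ()) j)
         (det-linearInRow n (minor A j) (minor B₁ j) (minor B₂ j) p α β
           (λ r r≢p c → A≈B₁ (suc r) (r≢p ∘ Finₚ.suc-injective) _)
           (λ r r≢p c → A≈B₂ (suc r) (r≢p ∘ Finₚ.suc-injective) _)
           (λ c → Ap≡ (punchIn j c))) ⟩
  sign (toℕ j) * B₁ zero j * (α * det n (minor B₁ j) + β * det n (minor B₂ j))
    ≡⟨ distribute (sign (toℕ j)) (B₁ zero j) α β _ _ ⟩
  α * (sign (toℕ j) * B₁ zero j * det n (minor B₁ j)) + β * (sign (toℕ j) * B₁ zero j * det n (minor B₂ j))
    ≡⟨ cong (λ b → α * _ + β * (sign (toℕ j) * b * det n (minor B₂ j)))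
            (trans (sym (A≈B₁ zero (λ ()) j)) (A≈B₂ zero (λ ()) j)) ⟩
  α * laplaceTerm B₁ j + β * laplaceTerm B₂ j ∎
  where
  distribute : ∀ s b α β x y → s * b * (α * x + β * y) ≡ α * (s * b * x) + β * (s * b * y)
  distribute = solve 6 (λ s b α β x y →
    s :* b :* (α :* x :+ β :* y) := α :* (s :* b :* x) :+ β :* (s :* b :* y)) refl

punchIn-punchIn : ∀ {n} (i : Fin (suc (suc n))) (j : Fin (suc n)) (i≢ : punchIn i j ≢ i) (c : Fin n) →
                  punchIn i (punchIn j c) ≡ punchIn (punchIn i j) (punchIn (punchOut i≢) c)
punchIn-punchIn zero    j       i≢ c       = refl
punchIn-punchIn (suc i) zero    i≢ c       = refl
punchIn-punchIn (suc i) (suc j) i≢ zero    = refl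
punchIn-punchIn (suc i) (suc j) i≢ (suc c) = cong suc (punchIn-punchIn i j (i≢ ∘ cong suc) c)

sign-punchIn-punchOut : ∀ {n} (i : Fin (suc (suc n))) (j : Fin (suc n)) (i≢ : punchIn i j ≢ i) →
                        sign (toℕ (punchIn i j)) * sign (toℕ (punchOut i≢)) ≡ - (sign (toℕ i) * sign (toℕ j))
sign-punchIn-punchOut zero    j       i≢ = begin
  sign (suc (toℕ j)) * 1ℚ   ≡⟨ cong (_* 1ℚ) (sign-suc (toℕ j)) ⟩
  - sign (toℕ j) * 1ℚ       ≡⟨ move-neg (sign (toℕ j)) ⟩
  - (1ℚ * sign (toℕ j))     ∎
  where
  move-neg : ∀ s → - s * 1ℚ ≡ - (1ℚ * s)
  move-neg = solve 1 (λ s → :- s :* con 1ℚ := :- (con 1ℚ :* s)) refl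
sign-punchIn-punchOut (suc i) zero    i≢ = begin
  1ℚ * sign (toℕ i)              ≡⟨ double-neg (sign (toℕ i)) ⟩
  - (- sign (toℕ i) * 1ℚ)        ≡⟨ cong (λ s → - (s * 1ℚ)) (sign-suc (toℕ i)) ⟨
  - (sign (suc (toℕ i)) * 1ℚ)    ∎
  where
  double-neg : ∀ s → 1ℚ * s ≡ - (- s * 1ℚ)
  double-neg = solve 1 (λ s → con 1ℚ :* s := :- (:- s :* con 1ℚ)) refl
sign-punchIn-punchOut {suc n} (suc i) (suc j) i≢ = begin
  sign (suc a) * sign (suc b)             ≡⟨ cong₂ _*_ (sign-suc a) (sign-suc b) ⟩
  - sign a * - sign b                     ≡⟨ neg*neg (sign a) (sign b) ⟩
  sign a * sign b                         ≡⟨ sign-punchIn-punchOut i j (i≢ ∘ cong suc) ⟩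
  - (sign (toℕ i) * sign (toℕ j))         ≡⟨ cong -_ (neg*neg (sign (toℕ i)) (sign (toℕ j))) ⟨
  - (- sign (toℕ i) * - sign (toℕ j))     ≡⟨ cong₂ (λ s t → - (s * t)) (sign-suc (toℕ i)) (sign-suc (toℕ j)) ⟨
  - (sign (suc (toℕ i)) * sign (suc (toℕ j))) ∎
  where
  a = toℕ (punchIn i j)
  b = toℕ (punchOut (i≢ ∘ cong suc))
  neg*neg : ∀ s t → - s * - t ≡ s * t
  neg*neg = solve 2 (λ s t → :- s :* :- t := s :* t) refl

-- Expanding along the first two rows writes det A as a sum over ordered pairs (j, j') of distinct
-- columns. Exchanging the two rows exchanges j and j': the remaining minors agree (punchIn-punchIn)
-- and the signs are opposite (sign-punchIn-punchOut), so the determinant changes sign.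
twoRowTerm : ∀ {n} → Matrix (suc (suc n)) → Fin (suc (suc n)) → Fin (suc n) → ℚ
twoRowTerm {n} A j c =
  (sign (toℕ j) * A zero j) * (sign (toℕ c) * A (suc zero) (punchIn j c) * det n (minor (minor A j) c))

pairTerm : ∀ {n} → Matrix (suc (suc n)) → Fin (suc (suc n)) → Fin (suc (suc n)) → ℚ
pairTerm A j j' with j Fin.≟ j'
... | yes _    = 0ℚ
... | no j≢j'  = twoRowTerm A j (punchOut j≢j')

pairTerm-diag : ∀ {n} (A : Matrix (suc (suc n))) j → pairTerm A j j ≡ 0ℚ
pairTerm-diag A j with j Fin.≟ j
... | yes _   = refl
... | no j≢j  = ⊥-elim (j≢j refl)

pairTerm-≢ : ∀ {n} (A : Matrix (suc (suc n))) j j' (j≢j' : j ≢ j') →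
             pairTerm A j j' ≡ twoRowTerm A j (punchOut j≢j')
pairTerm-≢ A j j' j≢j' with j Fin.≟ j'
... | yes j≡j' = ⊥-elim (j≢j' j≡j')
... | no _     = cong (twoRowTerm A j) (Finₚ.punchOut-cong j refl)

pairTerm-punchIn : ∀ {n} (A : Matrix (suc (suc n))) j c → pairTerm A j (punchIn j c) ≡ twoRowTerm A j c
pairTerm-punchIn A j c = trans (pairTerm-≢ A j _ (Finₚ.punchInᵢ≢i j c ∘ sym))
                               (cong (twoRowTerm A j) (Finₚ.punchOut-punchIn j))

det-pairExpansion : ∀ n (A : Matrix (suc (suc n))) →
                    det (suc (suc n)) A ≡ sumFin (suc (suc n)) (λ j → sumFin (suc (suc n)) (pairTerm A j))
det-pairExpansion n A = sumFin-cong (suc (suc n)) λ j → begin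
  sign (toℕ j) * A zero j * det (suc n) (minor A j)    ≡⟨ sumFin-*ˡ (suc n) (sign (toℕ j) * A zero j) (cofactor j) ⟨
  sumFin (suc n) (twoRowTerm A j)                      ≡⟨ sumFin-cong (suc n) (pairTerm-punchIn A j) ⟨
  sumFin (suc n) (pairTerm A j ∘ punchIn j)            ≡⟨ sumFin-punchIn (suc n) j {pairTerm A j} (pairTerm-diag A j) ⟨
  sumFin (suc (suc n)) (pairTerm A j)                  ∎
  where
  cofactor : Fin (suc (suc n)) → Fin (suc n) → ℚ
  cofactor j c = sign (toℕ c) * A (suc zero) (punchIn j c) * det n (minor (minor A j) c)

module _ {n} (A B : Matrix (suc (suc n)))
         (B₀≡A₁ : ∀ c → B zero c ≡ A (suc zero) c)
         (B₁≡A₀ : ∀ c → B (suc zero) c ≡ A zero c)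
         (B≡A : ∀ r c → B (suc (suc r)) c ≡ A (suc (suc r)) c) where

  twoRowTerm-swap : ∀ j c (j'≢j : punchIn j c ≢ j) →
                    twoRowTerm B (punchIn j c) (punchOut j'≢j) ≡ - twoRowTerm A j c
  twoRowTerm-swap j c j'≢j = begin
    (s' * B zero j') * (t' * B (suc zero) (punchIn j' c') * det n (minor (minor B j') c'))
      ≡⟨ cong₂ (λ a b → (s' * a) * (t' * b * det n (minor (minor B j') c'))) (B₀≡A₁ j')
               (trans (cong (B (suc zero)) (Finₚ.punchIn-punchOut j'≢j)) (B₁≡A₀ j)) ⟩
    (s' * A (suc zero) j') * (t' * A zero j * det n (minor (minor B j') c'))
      ≡⟨ cong (λ d → (s' * A (suc zero) j') * (t' * A zero j * d))
              (det-cong n (λ r d → trans (B≡A r _) (cong (A (suc (suc r))) (sym (punchIn-punchIn j c j'≢j d))))) ⟩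
    (s' * A (suc zero) j') * (t' * A zero j * Δ)
      ≡⟨ regroup s' t' (A zero j) (A (suc zero) j') Δ ⟩
    (s' * t') * (A zero j * A (suc zero) j' * Δ)
      ≡⟨ cong (_* (A zero j * A (suc zero) j' * Δ)) (sign-punchIn-punchOut j c j'≢j) ⟩
    - (s * t) * (A zero j * A (suc zero) j' * Δ)
      ≡⟨ ℚₚ.neg-distribˡ-* (s * t) _ ⟨
    - ((s * t) * (A zero j * A (suc zero) j' * Δ))
      ≡⟨ cong -_ (regroup′ s t (A zero j) (A (suc zero) j') Δ) ⟨
    - ((s * A zero j) * (t * A (suc zero) j' * Δ)) ∎
    where
    j' = punchIn j c
    c' = punchOut j'≢j
    s  = sign (toℕ j)
    t  = sign (toℕ c)
    s' = sign (toℕ j')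
    t' = sign (toℕ c')
    Δ  = det n (minor (minor A j) c)
    regroup : ∀ s t a b d → (s * b) * (t * a * d) ≡ (s * t) * (a * b * d)
    regroup = solve 5 (λ s t a b d → (s :* b) :* (t :* a :* d) := (s :* t) :* (a :* b :* d)) refl
    regroup′ : ∀ s t a b d → (s * a) * (t * b * d) ≡ (s * t) * (a * b * d)
    regroup′ = solve 5 (λ s t a b d → (s :* a) :* (t :* b :* d) := (s :* t) :* (a :* b :* d)) refl

  pairTerm-swap : ∀ j j' → pairTerm B j' j ≡ - pairTerm A j j'
  pairTerm-swap j j' with j Fin.≟ j'
  ... | yes refl = pairTerm-diag B j
  ... | no j≢j' = begin
    pairTerm B j' j                          ≡⟨ cong (λ k → pairTerm B k j) (Finₚ.punchIn-punchOut j≢j') ⟨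
    pairTerm B (punchIn j c) j               ≡⟨ pairTerm-≢ B (punchIn j c) j (Finₚ.punchInᵢ≢i j c) ⟩
    twoRowTerm B (punchIn j c) (punchOut (Finₚ.punchInᵢ≢i j c)) ≡⟨ twoRowTerm-swap j c (Finₚ.punchInᵢ≢i j c) ⟩
    - twoRowTerm A j c                       ∎
    where c = punchOut j≢j'

  det-swap₀₁ : det (suc (suc n)) B ≡ - det (suc (suc n)) A
  det-swap₀₁ = begin
    det (suc (suc n)) B                                ≡⟨ det-pairExpansion n B ⟩
    sumFin N (λ j → sumFin N (pairTerm B j))           ≡⟨ sumFin-comm N N (pairTerm B) ⟩
    sumFin N (λ j' → sumFin N (λ j → pairTerm B j j')) ≡⟨ sumFin-cong N (λ j' → sumFin-cong N (pairTerm-swap j')) ⟩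
    sumFin N (λ j' → sumFin N (λ j → - pairTerm A j' j)) ≡⟨ sumFin-cong N (λ j' → sumFin-neg N (pairTerm A j')) ⟩
    sumFin N (λ j' → - sumFin N (pairTerm A j'))       ≡⟨ sumFin-neg N (λ j' → sumFin N (pairTerm A j')) ⟩
    - sumFin N (λ j' → sumFin N (pairTerm A j'))       ≡⟨ cong -_ (det-pairExpansion n A) ⟨
    - det (suc (suc n)) A                              ∎
    where N = suc (suc n)

det-equalRows₀₁ : ∀ n (A : Matrix (suc (suc n))) → (∀ c → A zero c ≡ A (suc zero) c) → det (suc (suc n)) A ≡ 0ℚ
det-equalRows₀₁ n A A₀≡A₁ = x≡-x⇒x≡0 _ (det-swap₀₁ A A A₀≡A₁ (sym ∘ A₀≡A₁) (λ _ _ → refl))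

det-equalRows₀ : ∀ n (A : Matrix (suc n)) (j : Fin n) → (∀ c → A zero c ≡ A (suc j) c) → det (suc n) A ≡ 0ℚ
det-equalRows₀ (suc n) A zero    A₀≡Aⱼ = det-equalRows₀₁ n A A₀≡Aⱼ
det-equalRows₀ (suc n) A (suc j) A₀≡Aⱼ = begin
  det (suc (suc n)) A    ≡⟨ det-swap₀₁ B A (λ _ → refl) (λ _ → refl) (λ _ _ → refl) ⟩
  - det (suc (suc n)) B  ≡⟨ cong -_ (det-vanishingMinors (suc n) B λ k →
                                       det-equalRows₀ n (minor B k) j (A₀≡Aⱼ ∘ punchIn k)) ⟩
  - 0ℚ                   ≡⟨⟩
  0ℚ                     ∎
  where
  B : Matrix (suc (suc n))
  B zero          = A (suc zero)
  B (suc zero)    = A zero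
  B (suc (suc r)) = A (suc (suc r))

det-equalRows : ∀ n (A : Matrix n) {i j : Fin n} → i ≢ j → (∀ c → A i c ≡ A j c) → det n A ≡ 0ℚ
det-equalRows (suc n) A {zero}  {zero}  i≢j Aᵢ≡Aⱼ = ⊥-elim (i≢j refl)
det-equalRows (suc n) A {zero}  {suc j} i≢j Aᵢ≡Aⱼ = det-equalRows₀ n A j Aᵢ≡Aⱼ
det-equalRows (suc n) A {suc i} {zero}  i≢j Aᵢ≡Aⱼ = det-equalRows₀ n A i (sym ∘ Aᵢ≡Aⱼ)
det-equalRows (suc n) A {suc i} {suc j} i≢j Aᵢ≡Aⱼ = det-vanishingMinors n A λ k →
  det-equalRows n (minor A k) (i≢j ∘ cong suc) (Aᵢ≡Aⱼ ∘ punchIn k)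

replaceRow : ∀ {n} → Matrix n → Fin n → (Fin n → ℚ) → Matrix n
replaceRow A p v = updateAt A p (λ _ → v)

replaceRow-updates : ∀ {n} (A : Matrix n) p v c → replaceRow A p v p c ≡ v c
replaceRow-updates A p v c = cong (λ row → row c) (updateAt-updates p A)

replaceRow-minimal : ∀ {n} (A : Matrix n) p v → AgreeOffRow p (replaceRow A p v) A
replaceRow-minimal A p v r r≢p c = cong (λ row → row c) (updateAt-minimal r p A r≢p)

det-addCombination : ∀ n k (A B : Matrix n) (p : Fin n) (row : Fin k → Fin n) (w : Fin k → ℚ) →
                     (∀ t → row t ≡ p → w t ≡ 0ℚ) → AgreeOffRow p A B →
                     (∀ c → A p c ≡ B p c + sumFin k (λ t → w t * B (row t) c)) →
                     det n A ≡ det n B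
det-addCombination n zero A B p row w w≡0 A≈B Ap≡ = det-cong n A≡B
  where
  A≡B : ∀ r c → A r c ≡ B r c
  A≡B r c with r Fin.≟ p
  ... | yes refl = trans (Ap≡ c) (ℚₚ.+-identityʳ (B p c))
  ... | no r≢p   = A≈B r r≢p c
det-addCombination n (suc k) A B p row w w≡0 A≈B Ap≡ = begin
  det n A                             ≡⟨ det-linearInRow n A B₁ B₂ p 1ℚ (w zero) A≈B₁ A≈B₂ Ap≡B₁+B₂ ⟩
  1ℚ * det n B₁ + w zero * det n B₂   ≡⟨ cong (1ℚ * det n B₁ +_) w₀*detB₂≡0 ⟩
  1ℚ * det n B₁ + 0ℚ                  ≡⟨ one*x+0 (det n B₁) ⟩
  det n B₁                            ≡⟨ det-addCombination n k B₁ B p (row ∘ suc) (w ∘ suc) (w≡0 ∘ suc)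
                                           (replaceRow-minimal B p _) (replaceRow-updates B p _) ⟩
  det n B                             ∎
  where
  rest : Fin n → ℚ
  rest c = sumFin k (λ t → w (suc t) * B (row (suc t)) c)
  B₁ = replaceRow B p (λ c → B p c + rest c)
  B₂ = replaceRow B p (B (row zero))
  A≈B₁ : AgreeOffRow p A B₁
  A≈B₁ r r≢p c = trans (A≈B r r≢p c) (sym (replaceRow-minimal B p _ r r≢p c))
  A≈B₂ : AgreeOffRow p A B₂
  A≈B₂ r r≢p c = trans (A≈B r r≢p c) (sym (replaceRow-minimal B p _ r r≢p c))
  one*x+0 : ∀ x → 1ℚ * x + 0ℚ ≡ x
  one*x+0 = solve 1 (λ x → con 1ℚ :* x :+ con 0ℚ := x) refl
  regroup : ∀ b u v → b + (u + v) ≡ 1ℚ * (b + v) + u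
  regroup = solve 3 (λ b u v → b :+ (u :+ v) := con 1ℚ :* (b :+ v) :+ u) refl
  Ap≡B₁+B₂ : ∀ c → A p c ≡ 1ℚ * B₁ p c + w zero * B₂ p c
  Ap≡B₁+B₂ c = begin
    A p c                                              ≡⟨ Ap≡ c ⟩
    B p c + (w zero * B (row zero) c + rest c)         ≡⟨ regroup (B p c) _ (rest c) ⟩
    1ℚ * (B p c + rest c) + w zero * B (row zero) c    ≡⟨ cong₂ (λ x y → 1ℚ * x + w zero * y)
                                                            (replaceRow-updates B p _ c) (replaceRow-updates B p _ c) ⟨
    1ℚ * B₁ p c + w zero * B₂ p c                      ∎
  w₀*detB₂≡0 : w zero * det n B₂ ≡ 0ℚ
  w₀*detB₂≡0 with row zero Fin.≟ p
  ... | yes row₀≡p = trans (cong (_* det n B₂) (w≡0 zero row₀≡p)) (ℚₚ.*-zeroˡ (det n B₂))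
  ... | no row₀≢p  = trans (cong (w zero *_) detB₂≡0) (ℚₚ.*-zeroʳ (w zero))
    where
    detB₂≡0 : det n B₂ ≡ 0ℚ
    detB₂≡0 = det-equalRows n B₂ (row₀≢p ∘ sym) λ c →
      trans (replaceRow-updates B p _ c) (sym (replaceRow-minimal B p _ (row zero) row₀≢p c))

δ : ∀ {n} → Fin n → Fin n → ℚ
δ zero    zero    = 1ℚ
δ zero    (suc _) = 0ℚ
δ (suc _) zero    = 0ℚ
δ (suc i) (suc j) = δ i j

δ-diag : ∀ {n} (i : Fin n) → δ i i ≡ 1ℚ
δ-diag zero    = refl
δ-diag (suc i) = δ-diag i

δ-≢ : ∀ {n} {i j : Fin n} → i ≢ j → δ i j ≡ 0ℚ
δ-≢ {i = zero}  {zero}  i≢j = ⊥-elim (i≢j refl)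
δ-≢ {i = zero}  {suc j} i≢j = refl
δ-≢ {i = suc i} {zero}  i≢j = refl
δ-≢ {i = suc i} {suc j} i≢j = δ-≢ (i≢j ∘ cong suc)

sumFin-δ : ∀ n (k : Fin n) (f : Fin n → ℚ) → sumFin n (λ t → δ k t * f t) ≡ f k
sumFin-δ n k f = begin
  sumFin n (λ t → δ k t * f t)  ≡⟨ sumFin-single n k (λ t t≢k →
                                     trans (cong (_* f t) (δ-≢ (t≢k ∘ sym))) (ℚₚ.*-zeroˡ (f t))) ⟩
  δ k k * f k                   ≡⟨ cong (_* f k) (δ-diag k) ⟩
  1ℚ * f k                      ≡⟨ ℚₚ.*-identityˡ (f k) ⟩
  f k                           ∎

module _ (N : ℕ) (A M : Matrix N) (w : Fin N → Fin N → ℚ)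
         (w-upper : ∀ r t → toℕ r ≤ toℕ t → w r t ≡ 0ℚ)
         (A≡ : ∀ r c → A r c ≡ M r c + sumFin N (λ t → w r t * M t c)) where

  -- Rows are changed from A to M one at a time, top to bottom, so that the earlier rows
  -- combined into row k are already rows of M.
  private
    stage : ℕ → Matrix N
    stage k r with toℕ r ℕₚ.<? k
    ... | yes _ = M r
    ... | no _  = A r

    stage-lower : ∀ {k} r → toℕ r < k → stage k r ≡ M r
    stage-lower {k} r r<k with toℕ r ℕₚ.<? k
    ... | yes _  = refl
    ... | no r≮k = ⊥-elim (r≮k r<k)

    stage-upper : ∀ {k} r → k ≤ toℕ r → stage k r ≡ A r
    stage-upper {k} r k≤r with toℕ r ℕₚ.<? k
    ... | yes r<k = ⊥-elim (ℕₚ.<⇒≱ r<k k≤r)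
    ... | no _    = refl

    stage-step : ∀ {k} (k<N : k < N) → det N (stage k) ≡ det N (stage (suc k))
    stage-step {k} k<N = det-addCombination N N (stage k) (stage (suc k)) p id (w p) wₚₚ≡0 agree rowₚ
      where
      p = fromℕ< k<N
      p≡k : toℕ p ≡ k
      p≡k = Finₚ.toℕ-fromℕ< k<N
      wₚₚ≡0 : ∀ t → t ≡ p → w p t ≡ 0ℚ
      wₚₚ≡0 t refl = w-upper p p ℕₚ.≤-refl
      agree : AgreeOffRow p (stage k) (stage (suc k))
      agree r r≢p c with k ℕₚ.≤? toℕ r
      ... | yes k≤r = cong (λ row → row c) (trans (stage-upper r k≤r) (sym (stage-upper r k<r)))
        where
        k<r : k < toℕ r
        k<r = ℕₚ.≤∧≢⇒< k≤r (λ k≡r → r≢p (Finₚ.toℕ-injective (trans (sym k≡r) (sym p≡k))))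
      ... | no k≰r  = cong (λ row → row c) (trans (stage-lower r r<k) (sym (stage-lower r (ℕₚ.m<n⇒m<1+n r<k))))
        where
        r<k : toℕ r < k
        r<k = ℕₚ.≰⇒> k≰r
      combination≡ : ∀ c t → w p t * M t c ≡ w p t * stage (suc k) t c
      combination≡ c t with toℕ t ℕₚ.<? k
      ... | yes t<k = cong (λ row → w p t * row c) (sym (stage-lower t (ℕₚ.m<n⇒m<1+n t<k)))
      ... | no t≮k  = begin
        w p t * M t c                ≡⟨ cong (_* M t c) wₚₜ≡0 ⟩
        0ℚ * M t c                   ≡⟨ ℚₚ.*-zeroˡ (M t c) ⟩
        0ℚ                           ≡⟨ ℚₚ.*-zeroˡ (stage (suc k) t c) ⟨
        0ℚ * stage (suc k) t c       ≡⟨ cong (_* stage (suc k) t c) wₚₜ≡0 ⟨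
        w p t * stage (suc k) t c    ∎
        where
        wₚₜ≡0 = w-upper p t (subst (_≤ toℕ t) (sym p≡k) (ℕₚ.≮⇒≥ t≮k))
      rowₚ : ∀ c → stage k p c ≡ stage (suc k) p c + sumFin N (λ t → w p t * stage (suc k) t c)
      rowₚ c = begin
        stage k p c
          ≡⟨ cong (λ row → row c) (stage-upper p (ℕₚ.≤-reflexive (sym p≡k))) ⟩
        A p c
          ≡⟨ A≡ p c ⟩
        M p c + sumFin N (λ t → w p t * M t c)
          ≡⟨ cong₂ _+_ (cong (λ row → row c) (sym (stage-lower p (ℕₚ.≤-reflexive (cong suc p≡k)))))
                       (sumFin-cong N (combination≡ c)) ⟩
        stage (suc k) p c + sumFin N (λ t → w p t * stage (suc k) t c) ∎

    det-stage : ∀ k → k ≤ N → det N (stage k) ≡ det N A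
    det-stage zero    _     = det-cong N (λ r c → cong (λ row → row c) (stage-upper r z≤n))
    det-stage (suc k) k<N   = trans (sym (stage-step k<N)) (det-stage k (ℕₚ.<⇒≤ k<N))

  det-addEarlierRows : det N A ≡ det N M
  det-addEarlierRows = begin
    det N A          ≡⟨ det-stage N ℕₚ.≤-refl ⟨
    det N (stage N)  ≡⟨ det-cong N (λ r c → cong (λ row → row c) (stage-lower r (Finₚ.toℕ<n r))) ⟩
    det N M          ∎

det-unitriangular : ∀ N (L M : Matrix N) → (∀ i j → toℕ i < toℕ j → L i j ≡ 0ℚ) → (∀ i → L i i ≡ 1ℚ) →
                    det N (λ i c → sumFin N (λ j → L i j * M j c)) ≡ det N M
det-unitriangular N L M L-upper L-diag = det-addEarlierRows N _ M (λ i j → L i j - δ i j) w-upper A≡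
  where
  w-upper : ∀ i j → toℕ i ≤ toℕ j → L i j - δ i j ≡ 0ℚ
  w-upper i j i≤j with i Fin.≟ j
  ... | yes refl = trans (cong₂ _-_ (L-diag i) (δ-diag i)) (ℚₚ.+-inverseʳ 1ℚ)
  ... | no i≢j   = trans (cong₂ _-_ (L-upper i j (ℕₚ.≤∧≢⇒< i≤j (i≢j ∘ Finₚ.toℕ-injective))) (δ-≢ i≢j))
                         (ℚₚ.+-inverseʳ 0ℚ)
  split : ∀ l d m → l * m ≡ d * m + (l - d) * m
  split = solve 3 (λ l d m → l :* m := d :* m :+ (l :- d) :* m) refl
  A≡ : ∀ i c → sumFin N (λ j → L i j * M j c) ≡ M i c + sumFin N (λ j → (L i j - δ i j) * M j c)
  A≡ i c = begin
    sumFin N (λ j → L i j * M j c)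
      ≡⟨ sumFin-cong N (λ j → split (L i j) (δ i j) (M j c)) ⟩
    sumFin N (λ j → δ i j * M j c + (L i j - δ i j) * M j c)
      ≡⟨ sumFin-+ N _ _ ⟩
    sumFin N (λ j → δ i j * M j c) + sumFin N (λ j → (L i j - δ i j) * M j c)
      ≡⟨ cong (_+ sumFin N (λ j → (L i j - δ i j) * M j c)) (sumFin-δ N i (λ j → M j c)) ⟩
    M i c + sumFin N (λ j → (L i j - δ i j) * M j c) ∎

subtractPreviousRow : ∀ {N} → ℚ → Matrix (suc N) → Matrix (suc N)
subtractPreviousRow a A zero    c = A zero c
subtractPreviousRow a A (suc r) c = A (suc r) c - a * A (inject₁ r) c

det-subtractPreviousRow : ∀ N a (A : Matrix (suc N)) → det (suc N) (subtractPreviousRow a A) ≡ det (suc N) A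
det-subtractPreviousRow N a A = det-addEarlierRows (suc N) (subtractPreviousRow a A) A w w-upper A'≡
  where
  w : Fin (suc N) → Fin (suc N) → ℚ
  w zero    t = 0ℚ
  w (suc r) t = - a * δ (inject₁ r) t
  w-upper : ∀ r t → toℕ r ≤ toℕ t → w r t ≡ 0ℚ
  w-upper zero    t _   = refl
  w-upper (suc r) t r<t = trans (cong (- a *_) (δ-≢ r≢t)) (ℚₚ.*-zeroʳ (- a))
    where
    r≢t : inject₁ r ≢ t
    r≢t refl = ℕₚ.<-irrefl (sym (Finₚ.toℕ-inject₁ r)) r<t
  A'≡ : ∀ r c → subtractPreviousRow a A r c ≡ A r c + sumFin (suc N) (λ t → w r t * A t c)
  A'≡ zero    c = sym (trans (cong (A zero c +_) (sumFin-zero (suc N) (λ t → ℚₚ.*-zeroˡ (A t c))))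
                             (ℚₚ.+-identityʳ (A zero c)))
  A'≡ (suc r) c = begin
    A (suc r) c - a * A (inject₁ r) c
      ≡⟨ cong (A (suc r) c +_) (ℚₚ.neg-distribˡ-* a (A (inject₁ r) c)) ⟩
    A (suc r) c + - a * A (inject₁ r) c
      ≡⟨ cong (λ y → A (suc r) c + - a * y) (sumFin-δ (suc N) (inject₁ r) (λ t → A t c)) ⟨
    A (suc r) c + - a * sumFin (suc N) (λ t → δ (inject₁ r) t * A t c)
      ≡⟨ cong (A (suc r) c +_) (sumFin-*ˡ (suc N) (- a) (λ t → δ (inject₁ r) t * A t c)) ⟨
    A (suc r) c + sumFin (suc N) (λ t → - a * (δ (inject₁ r) t * A t c))
      ≡⟨ cong (A (suc r) c +_) (sumFin-cong (suc N) (λ t → sym (ℚₚ.*-assoc (- a) (δ (inject₁ r) t) (A t c)))) ⟩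
    A (suc r) c + sumFin (suc N) (λ t → - a * δ (inject₁ r) t * A t c) ∎

det-scaleRows : ∀ n (g : Fin n → ℚ) (A : Matrix n) → det n (λ r c → g r * A r c) ≡ prodFin n g * det n A
det-scaleRows zero    g A = sym (ℚₚ.*-identityˡ 1ℚ)
det-scaleRows (suc n) g A = begin
  sumFin (suc n) (λ j → sign (toℕ j) * (g zero * A zero j) * det n (λ r c → g (suc r) * minor A j r c))
    ≡⟨ sumFin-cong (suc n) (λ j → trans
         (cong (sign (toℕ j) * (g zero * A zero j) *_) (det-scaleRows n (g ∘ suc) (minor A j)))
         (regroup (sign (toℕ j)) (g zero) (A zero j) (prodFin n (g ∘ suc)) (det n (minor A j)))) ⟩
  sumFin (suc n) (λ j → prodFin (suc n) g * (sign (toℕ j) * A zero j * det n (minor A j)))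
    ≡⟨ sumFin-*ˡ (suc n) (prodFin (suc n) g) (laplaceTerm A) ⟩
  prodFin (suc n) g * det (suc n) A ∎
  where
  regroup : ∀ s g a p d → s * (g * a) * (p * d) ≡ (g * p) * (s * a * d)
  regroup = solve 5 (λ s g a p d → s :* (g :* a) :* (p :* d) := (g :* p) :* (s :* a :* d)) refl

det-scaleColumns : ∀ n (f : Fin n → ℚ) (A : Matrix n) → det n (λ r c → f c * A r c) ≡ prodFin n f * det n A
det-scaleColumns zero    f A = sym (ℚₚ.*-identityˡ 1ℚ)
det-scaleColumns (suc n) f A = begin
  sumFin (suc n) (λ j → sign (toℕ j) * (f j * A zero j) * det n (λ r c → f (punchIn j c) * minor A j r c))
    ≡⟨ sumFin-cong (suc n) (λ j → begin
         sign (toℕ j) * (f j * A zero j) * det n (λ r c → f (punchIn j c) * minor A j r c)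
           ≡⟨ cong (sign (toℕ j) * (f j * A zero j) *_) (det-scaleColumns n (f ∘ punchIn j) (minor A j)) ⟩
         sign (toℕ j) * (f j * A zero j) * (prodFin n (f ∘ punchIn j) * det n (minor A j))
           ≡⟨ regroup (sign (toℕ j)) (f j) (A zero j) _ (det n (minor A j)) ⟩
         (f j * prodFin n (f ∘ punchIn j)) * (sign (toℕ j) * A zero j * det n (minor A j))
           ≡⟨ cong (_* (sign (toℕ j) * A zero j * det n (minor A j))) (prodFin-punchIn n j f) ⟨
         prodFin (suc n) f * (sign (toℕ j) * A zero j * det n (minor A j)) ∎) ⟩
  sumFin (suc n) (λ j → prodFin (suc n) f * (sign (toℕ j) * A zero j * det n (minor A j)))
    ≡⟨ sumFin-*ˡ (suc n) (prodFin (suc n) f) (laplaceTerm A) ⟩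
  prodFin (suc n) f * det (suc n) A ∎
  where
  regroup : ∀ s g a p d → s * (g * a) * (p * d) ≡ (g * p) * (s * a * d)
  regroup = solve 5 (λ s g a p d → s :* (g :* a) :* (p :* d) := (g :* p) :* (s :* a :* d)) refl

mutual
  det-zeroColumn : ∀ n (A : Matrix n) k → (∀ r → A r k ≡ 0ℚ) → det n A ≡ 0ℚ
  det-zeroColumn (suc n) A k col≡0 = sumFin-zero (suc n) term≡0
    where
    term≡0 : ∀ j → laplaceTerm A j ≡ 0ℚ
    term≡0 j with j Fin.≟ k
    ... | yes refl = begin
      sign (toℕ j) * A zero j * det n (minor A j)  ≡⟨ cong (λ a → sign (toℕ j) * a * det n (minor A j)) (col≡0 zero) ⟩
      sign (toℕ j) * 0ℚ * det n (minor A j)        ≡⟨ cong (_* det n (minor A j)) (ℚₚ.*-zeroʳ (sign (toℕ j))) ⟩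
      0ℚ * det n (minor A j)                       ≡⟨ ℚₚ.*-zeroˡ (det n (minor A j)) ⟩
      0ℚ                                           ∎
    ... | no j≢k = trans (cong (sign (toℕ j) * A zero j *_) (det-minor-zeroColumn n A k (col≡0 ∘ suc) j≢k))
                         (ℚₚ.*-zeroʳ (sign (toℕ j) * A zero j))

  det-minor-zeroColumn : ∀ n (A : Matrix (suc n)) k → (∀ r → A (suc r) k ≡ 0ℚ) →
                         ∀ {j} → j ≢ k → det n (minor A j) ≡ 0ℚ
  det-minor-zeroColumn n A k col≡0 j≢k = det-zeroColumn n (minor A _) (punchOut j≢k)
    (λ r → trans (cong (A (suc r)) (Finₚ.punchIn-punchOut j≢k)) (col≡0 r))

det-pivot : ∀ n (A : Matrix (suc n)) k → (∀ r → A (suc r) k ≡ 0ℚ) → det (suc n) A ≡ laplaceTerm A k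
det-pivot n A k col≡0 = sumFin-single (suc n) k λ j j≢k →
  trans (cong (sign (toℕ j) * A zero j *_) (det-minor-zeroColumn n A k col≡0 j≢k))
        (ℚₚ.*-zeroʳ (sign (toℕ j) * A zero j))

-- signedElementarySum D x s = Σₘ (-1)ᵐ e_{D-m}(x) sₘ, with eₖ the elementary symmetric polynomials.
signedElementarySum : (D : ℕ) → (Fin D → ℚ) → (ℕ → ℚ) → ℚ
signedElementarySum zero    x s = s 0
signedElementarySum (suc D) x s =
  x zero * signedElementarySum D (x ∘ suc) s + signedElementarySum D (x ∘ suc) (λ m → - s (suc m))

signedElementarySum-cong : ∀ D x {s t : ℕ → ℚ} → s ≗ t → signedElementarySum D x s ≡ signedElementarySum D x t
signedElementarySum-cong zero    x s≗t = s≗t 0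
signedElementarySum-cong (suc D) x s≗t = cong₂ (λ u v → x zero * u + v)
  (signedElementarySum-cong D (x ∘ suc) s≗t) (signedElementarySum-cong D (x ∘ suc) (cong -_ ∘ s≗t ∘ suc))

signedElementarySum-linear : ∀ D x (a b : ℚ) (s t : ℕ → ℚ) →
  signedElementarySum D x (λ m → a * s m + b * t m) ≡ a * signedElementarySum D x s + b * signedElementarySum D x t
signedElementarySum-linear zero    x a b s t = refl
signedElementarySum-linear (suc D) x a b s t = begin
  x₀ * S x' (λ m → a * s m + b * t m) + S x' (λ m → - (a * s (suc m) + b * t (suc m)))
    ≡⟨ cong₂ (λ u v → x₀ * u + v) (signedElementarySum-linear D x' a b s t)
         (trans (signedElementarySum-cong D x' (λ m → neg-linear a b (s (suc m)) (t (suc m))))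
                (signedElementarySum-linear D x' a b (λ m → - s (suc m)) (λ m → - t (suc m)))) ⟩
  x₀ * (a * S x' s + b * S x' t) + (a * S x' (λ m → - s (suc m)) + b * S x' (λ m → - t (suc m)))
    ≡⟨ regroup x₀ a b (S x' s) (S x' t) _ _ ⟩
  a * (x₀ * S x' s + S x' (λ m → - s (suc m))) + b * (x₀ * S x' t + S x' (λ m → - t (suc m))) ∎
  where
  S = signedElementarySum D
  x₀ = x zero
  x' = x ∘ suc
  neg-linear : ∀ a b u v → - (a * u + b * v) ≡ a * - u + b * - v
  neg-linear = solve 4 (λ a b u v → :- (a :* u :+ b :* v) := a :* :- u :+ b :* :- v) refl
  regroup : ∀ x₀ a b p q r u → x₀ * (a * p + b * q) + (a * r + b * u) ≡ a * (x₀ * p + r) + b * (x₀ * q + u)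
  regroup = solve 7 (λ x₀ a b p q r u →
    x₀ :* (a :* p :+ b :* q) :+ (a :* r :+ b :* u) := a :* (x₀ :* p :+ r) :+ b :* (x₀ :* q :+ u)) refl

signedElementarySum-scale : ∀ D x (a : ℚ) (s : ℕ → ℚ) →
  signedElementarySum D x (λ m → a * s m) ≡ a * signedElementarySum D x s
signedElementarySum-scale D x a s = begin
  signedElementarySum D x (λ m → a * s m)                       ≡⟨ signedElementarySum-cong D x (λ m → sym (drop a (s m))) ⟩
  signedElementarySum D x (λ m → a * s m + 0ℚ * s m)            ≡⟨ signedElementarySum-linear D x a 0ℚ s s ⟩
  a * signedElementarySum D x s + 0ℚ * signedElementarySum D x s ≡⟨ drop a (signedElementarySum D x s) ⟩
  a * signedElementarySum D x s                                 ∎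
  where
  drop : ∀ a k → a * k + 0ℚ * k ≡ a * k
  drop = solve 2 (λ a k → a :* k :+ con 0ℚ :* k := a :* k) refl

signedElementarySum-neg : ∀ D x (s : ℕ → ℚ) → signedElementarySum D x (λ m → - s m) ≡ - signedElementarySum D x s
signedElementarySum-neg D x s = begin
  signedElementarySum D x (λ m → - s m)        ≡⟨ signedElementarySum-cong D x (λ m → neg≡-1* (s m)) ⟩
  signedElementarySum D x (λ m → - 1ℚ * s m)   ≡⟨ signedElementarySum-scale D x (- 1ℚ) s ⟩
  - 1ℚ * signedElementarySum D x s             ≡⟨ neg≡-1* (signedElementarySum D x s) ⟨
  - signedElementarySum D x s                  ∎
  where
  neg≡-1* : ∀ y → - y ≡ - 1ℚ * y
  neg≡-1* = solve 1 (λ y → :- y := :- con 1ℚ :* y) refl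

signedElementarySum-atZero : ∀ D s → signedElementarySum D (λ _ → 0ℚ) s ≡ sign D * s D
signedElementarySum-atZero zero    s = sym (ℚₚ.*-identityˡ (s 0))
signedElementarySum-atZero (suc D) s = begin
  0ℚ * S₀ s + S₀ (λ m → - s (suc m))        ≡⟨ cong₂ (λ u v → 0ℚ * u + v) (signedElementarySum-atZero D s)
                                                                        (signedElementarySum-atZero D _) ⟩
  0ℚ * (sign D * s D) + sign D * - s (suc D)  ≡⟨ simplify (sign D) (s D) (s (suc D)) ⟩
  - sign D * s (suc D)                         ≡⟨ cong (_* s (suc D)) (sign-suc D) ⟨
  sign (suc D) * s (suc D)                     ∎
  where
  S₀ = signedElementarySum D (λ _ → 0ℚ)
  simplify : ∀ a b c → 0ℚ * (a * b) + a * - c ≡ - a * c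
  simplify = solve 3 (λ a b c → con 0ℚ :* (a :* b) :+ a :* :- c := :- a :* c) refl

borderedVandermonde : (D : ℕ) → (ℕ → ℚ) → (Fin D → ℚ) → Matrix (suc D)
borderedVandermonde D s x n zero    = s (toℕ n)
borderedVandermonde D s x n (suc k) = x k ^ℚ toℕ n

vandermonde-suc : ∀ E (x : Fin (suc E) → ℚ) →
  vandermonde (suc E) x ≡ prodFin E (λ j → x (suc j) - x zero) * vandermonde E (x ∘ suc)
vandermonde-suc E x = begin
  prodFin (suc E) (λ _ → 1ℚ) * prodFin E (λ j → (x (suc j) - x zero) * inner j)
    ≡⟨ cong₂ _*_ (prodFin-one (suc E) (λ _ → refl)) (prodFin-* E _ inner) ⟩
  1ℚ * (prodFin E (λ j → x (suc j) - x zero) * vandermonde E (x ∘ suc))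
    ≡⟨ ℚₚ.*-identityˡ _ ⟩
  prodFin E (λ j → x (suc j) - x zero) * vandermonde E (x ∘ suc) ∎
  where
  inner : Fin E → ℚ
  inner j = prodFin E (λ i → if toℕ i ℕ.<ᵇ toℕ j then x (suc j) - x (suc i) else 1ℚ)

det-borderedVandermonde : ∀ D s x →
  det (suc D) (borderedVandermonde D s x) ≡ vandermonde D x * signedElementarySum D x s
det-borderedVandermonde zero    s x = det₁ (s 0)
  where
  det₁ : ∀ a → 1ℚ * a * 1ℚ + 0ℚ ≡ 1ℚ * a
  det₁ = solve 1 (λ a → con 1ℚ :* a :* con 1ℚ :+ con 0ℚ := con 1ℚ :* a) refl
det-borderedVandermonde (suc E) s x = begin
  det (suc (suc E)) A                                ≡⟨ det-subtractPreviousRow (suc E) x₀ A ⟨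
  det (suc (suc E)) A'                               ≡⟨ det-pivot (suc E) A' (suc zero) column₁≡0 ⟩
  - 1ℚ * 1ℚ * det (suc E) (minor A' (suc zero))      ≡⟨ cong (- 1ℚ * 1ℚ *_) det-minor ⟩
  - 1ℚ * 1ℚ * (P * (V' * S x' s'))                   ≡⟨ cong (λ k → - 1ℚ * 1ℚ * (P * (V' * k))) S-s'≡ ⟩
  - 1ℚ * 1ℚ * (P * (V' * (S x' (s ∘ suc) + - x₀ * S x' s)))
    ≡⟨ regroup P V' (S x' (s ∘ suc)) (S x' s) x₀ ⟩
  (P * V') * (x₀ * S x' s + - S x' (s ∘ suc))
    ≡⟨ cong₂ (λ u v → u * (x₀ * S x' s + v)) (vandermonde-suc E x) (signedElementarySum-neg E x' (s ∘ suc)) ⟨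
  vandermonde (suc E) x * S x s                      ∎
  where
  S : ∀ {D} → (Fin D → ℚ) → (ℕ → ℚ) → ℚ
  S {D} = signedElementarySum D
  A  = borderedVandermonde (suc E) s x
  x₀ = x zero
  x' = x ∘ suc
  A' = subtractPreviousRow x₀ A
  s' = λ m → s (suc m) - x₀ * s m
  B  = borderedVandermonde E s' x'
  P  = prodFin E (λ j → x (suc j) - x₀)
  V' = vandermonde E x'
  f : Fin (suc E) → ℚ
  f zero    = 1ℚ
  f (suc c) = x (suc c) - x₀
  column₁≡0 : ∀ r → A' (suc r) (suc zero) ≡ 0ℚ
  column₁≡0 r = trans (cong (λ k → x₀ * x₀ ^ℚ toℕ r - x₀ * x₀ ^ℚ k) (Finₚ.toℕ-inject₁ r))
                      (ℚₚ.+-inverseʳ (x₀ * x₀ ^ℚ toℕ r))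
  factor : ∀ y x₀ z → y * z - x₀ * z ≡ (y - x₀) * z
  factor = solve 3 (λ y x₀ z → y :* z :- x₀ :* z := (y :- x₀) :* z) refl
  minor≡ : ∀ r c → minor A' (suc zero) r c ≡ f c * B r c
  minor≡ r zero    = trans (cong (λ k → s (suc (toℕ r)) - x₀ * s k) (Finₚ.toℕ-inject₁ r))
                           (sym (ℚₚ.*-identityˡ (s' (toℕ r))))
  minor≡ r (suc c) = trans (cong (λ k → y * y ^ℚ toℕ r - x₀ * y ^ℚ k) (Finₚ.toℕ-inject₁ r))
                           (factor y x₀ (y ^ℚ toℕ r))
    where y = x (suc c)
  det-minor : det (suc E) (minor A' (suc zero)) ≡ P * (V' * S x' s')
  det-minor = begin
    det (suc E) (minor A' (suc zero))       ≡⟨ det-cong (suc E) minor≡ ⟩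
    det (suc E) (λ r c → f c * B r c)       ≡⟨ det-scaleColumns (suc E) f B ⟩
    (1ℚ * P) * det (suc E) B                ≡⟨ cong₂ _*_ (ℚₚ.*-identityˡ P) (det-borderedVandermonde E s' x') ⟩
    P * (V' * S x' s')                      ∎
  S-s'≡ : S x' s' ≡ S x' (s ∘ suc) + - x₀ * S x' s
  S-s'≡ = begin
    S x' s'                                          ≡⟨ signedElementarySum-cong E x' (λ m → split (s (suc m)) x₀ (s m)) ⟩
    S x' (λ m → 1ℚ * s (suc m) + - x₀ * s m)         ≡⟨ signedElementarySum-linear E x' 1ℚ (- x₀) (s ∘ suc) s ⟩
    1ℚ * S x' (s ∘ suc) + - x₀ * S x' s              ≡⟨ cong (_+ - x₀ * S x' s) (ℚₚ.*-identityˡ (S x' (s ∘ suc))) ⟩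
    S x' (s ∘ suc) + - x₀ * S x' s                   ∎
    where
    split : ∀ a x₀ b → a - x₀ * b ≡ 1ℚ * a + - x₀ * b
    split = solve 3 (λ a x₀ b → a :- x₀ :* b := con 1ℚ :* a :+ :- x₀ :* b) refl
  regroup : ∀ P V k₁ k₀ x₀ → - 1ℚ * 1ℚ * (P * (V * (k₁ + - x₀ * k₀))) ≡ (P * V) * (x₀ * k₀ + - k₁)
  regroup = solve 5 (λ P V k₁ k₀ x₀ →
    :- con 1ℚ :* con 1ℚ :* (P :* (V :* (k₁ :+ :- x₀ :* k₀))) := (P :* V) :* (x₀ :* k₀ :+ :- k₁)) refl

nth-∷ʳ-< : ∀ xs y k → k < length xs → nth (xs ∷ʳ y) k ≡ nth xs k
nth-∷ʳ-< (x ∷ xs) y zero    _   = refl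
nth-∷ʳ-< (x ∷ xs) y (suc k) k<n = nth-∷ʳ-< xs y k (ℕₚ.≤-pred k<n)

nth-∷ʳ-length : ∀ xs y → nth (xs ∷ʳ y) (length xs) ≡ y
nth-∷ʳ-length []       y = refl
nth-∷ʳ-length (x ∷ xs) y = nth-∷ʳ-length xs y

length-bernList : ∀ m → length (bernList m) ≡ suc m
length-bernList zero    = refl
length-bernList (suc m) = trans (Listₚ.length-++ (bernList m))
                                (trans (cong (ℕ._+ 1) (length-bernList m)) (ℕₚ.+-comm (suc m) 1))

nth-bernList : ∀ m k → k ≤ m → nth (bernList m) k ≡ bernoulli k
nth-bernList zero    zero z≤n = refl
nth-bernList (suc m) k k≤m with ℕₚ.m≤n⇒m<n∨m≡n k≤m
... | inj₂ refl = refl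
... | inj₁ k<m  = trans (nth-∷ʳ-< (bernList m) _ k (subst (k <_) (sym (length-bernList m)) k<m))
                        (nth-bernList m k (ℕₚ.≤-pred k<m))

bernoulli-suc : ∀ m → bernoulli (suc m) ≡
  - ((ℤ.+ 1 / suc (suc m)) * Σ< (suc m) (λ k → ℕ→ℚ (suc (suc m) C k) * bernoulli k))
bernoulli-suc m = begin
  nth (bernList m ∷ʳ next) (suc m)            ≡⟨ cong (nth (bernList m ∷ʳ next)) (length-bernList m) ⟨
  nth (bernList m ∷ʳ next) (length (bernList m)) ≡⟨ nth-∷ʳ-length (bernList m) next ⟩
  next                                        ≡⟨ cong (λ z → - ((ℤ.+ 1 / suc (suc m)) * z))
                                                   (Σ<-cong (suc m) (λ k k<m → cong (ℕ→ℚ (suc (suc m) C k) *_)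
                                                                                    (nth-bernList m k (ℕₚ.≤-pred k<m)))) ⟩
  - ((ℤ.+ 1 / suc (suc m)) * Σ< (suc m) (λ k → ℕ→ℚ (suc (suc m) C k) * bernoulli k)) ∎
  where
  next = - ((ℤ.+ 1 / suc (suc m)) * Σ< (suc m) (λ k → ℕ→ℚ (suc (suc m) C k) * nth (bernList m) k))

bernoulli-binomialSum : ∀ m → Σ< (suc (suc m)) (λ k → ℕ→ℚ (suc (suc m) C k) * bernoulli k) ≡ 0ℚ
bernoulli-binomialSum m = begin
  S + ℕ→ℚ (suc (suc m) C suc m) * bernoulli (suc m) ≡⟨ cong₂ (λ c b → S + ℕ→ℚ c * b) C≡ (bernoulli-suc m) ⟩
  S + ℕ→ℚ (suc (suc m)) * - (h * S)                 ≡⟨ factor S (ℕ→ℚ (suc (suc m))) h ⟩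
  S * (1ℚ - ℕ→ℚ (suc (suc m)) * h)                  ≡⟨ cong (λ z → S * (1ℚ - z)) (ℕ→ℚ-*-inverse (suc m)) ⟩
  S * (1ℚ - 1ℚ)                                     ≡⟨ cong (S *_) (ℚₚ.+-inverseʳ 1ℚ) ⟩
  S * 0ℚ                                            ≡⟨ ℚₚ.*-zeroʳ S ⟩
  0ℚ                                                ∎
  where
  S = Σ< (suc m) (λ k → ℕ→ℚ (suc (suc m) C k) * bernoulli k)
  h = ℤ.+ 1 / suc (suc m)
  C≡ : suc (suc m) C suc m ≡ suc (suc m)
  C≡ = trans (nCk≡nC[n∸k] (ℕₚ.n≤1+n (suc m)))
             (trans (cong (suc (suc m) C_) (ℕₚ.m+n∸n≡m 1 m)) (nC1≡n (suc (suc m))))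
  factor : ∀ S n h → S + n * - (h * S) ≡ S * (1ℚ - n * h)
  factor = solve 3 (λ S n h → S :+ n :* :- (h :* S) := S :* (con 1ℚ :- n :* h)) refl

suc-*-C-suc : ∀ n j → suc j ℕ.* (suc n C suc j) ≡ suc n ℕ.* (n C j)
suc-*-C-suc zero    zero    = refl
suc-*-C-suc zero    (suc j) = begin
  suc (suc j) ℕ.* (1 C suc (suc j)) ≡⟨ cong (suc (suc j) ℕ.*_) (k>n⇒nCk≡0 {1} {suc (suc j)} (s≤s (s≤s z≤n))) ⟩
  suc (suc j) ℕ.* 0                 ≡⟨ ℕₚ.*-zeroʳ (suc (suc j)) ⟩
  0                                 ≡⟨ cong (1 ℕ.*_) (k>n⇒nCk≡0 {0} {suc j} (s≤s z≤n)) ⟨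
  1 ℕ.* (0 C suc j)                 ∎
suc-*-C-suc (suc n) zero    = begin
  1 ℕ.* (suc (suc n) C 1)   ≡⟨ ℕₚ.*-identityˡ _ ⟩
  suc (suc n) C 1           ≡⟨ nC1≡n (suc (suc n)) ⟩
  suc (suc n)               ≡⟨ ℕₚ.*-identityʳ (suc (suc n)) ⟨
  suc (suc n) ℕ.* 1         ≡⟨ cong (suc (suc n) ℕ.*_) (trans (nCk≡nC[n∸k] {0} {suc n} z≤n) (nCn≡1 (suc n))) ⟨
  suc (suc n) ℕ.* (suc n C 0) ∎
suc-*-C-suc (suc n) (suc j) = begin
  suc (suc j) ℕ.* (suc (suc n) C suc (suc j))   ≡⟨ cong (suc (suc j) ℕ.*_) (nCk+nC[k+1]≡[n+1]C[k+1] (suc n) (suc j)) ⟨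
  suc (suc j) ℕ.* (a ℕ.+ b)                     ≡⟨ expand j a b ⟩
  (suc j ℕ.* a ℕ.+ a) ℕ.+ suc (suc j) ℕ.* b     ≡⟨ cong₂ (λ u v → (u ℕ.+ a) ℕ.+ v) (suc-*-C-suc n j) (suc-*-C-suc n (suc j)) ⟩
  (suc n ℕ.* (n C j) ℕ.+ a) ℕ.+ suc n ℕ.* (n C suc j) ≡⟨ collect n (n C j) (n C suc j) a ⟩
  suc n ℕ.* (n C j ℕ.+ n C suc j) ℕ.+ a         ≡⟨ cong (λ u → suc n ℕ.* u ℕ.+ a) (nCk+nC[k+1]≡[n+1]C[k+1] n j) ⟩
  suc n ℕ.* a ℕ.+ a                             ≡⟨ ℕₚ.+-comm (suc n ℕ.* a) a ⟩
  suc (suc n) ℕ.* a                             ∎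
  where
  a = suc n C suc j
  b = suc n C suc (suc j)
  expand : ∀ j a b → suc (suc j) ℕ.* (a ℕ.+ b) ≡ (suc j ℕ.* a ℕ.+ a) ℕ.+ suc (suc j) ℕ.* b
  expand = ℕ-RingSolver.solve-∀
  collect : ∀ n c d a → (suc n ℕ.* c ℕ.+ a) ℕ.+ suc n ℕ.* d ≡ suc n ℕ.* (c ℕ.+ d) ℕ.+ a
  collect = ℕ-RingSolver.solve-∀

bernoulliCoefficient : ℕ → ℕ → ℚ
bernoulliCoefficient n j = ℕ→ℚ (n C j) * bernoulli (n ∸ j)

bernoulliCoefficient-upper : ∀ n j → n < j → bernoulliCoefficient n j ≡ 0ℚ
bernoulliCoefficient-upper n j n<j =
  trans (cong (λ c → ℕ→ℚ c * bernoulli (n ∸ j)) (k>n⇒nCk≡0 n<j)) (ℚₚ.*-zeroˡ (bernoulli (n ∸ j)))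

bernoulliCoefficient-diag : ∀ n → bernoulliCoefficient n n ≡ 1ℚ
bernoulliCoefficient-diag n = cong₂ (λ c m → ℕ→ℚ c * bernoulli m) (nCn≡1 n) (ℕₚ.n∸n≡0 n)

-- ∫₀¹ xʲ dx
monomialIntegral : ℕ → ℚ
monomialIntegral j = ℤ.+ 1 / suc j

C-*-monomialIntegral : ∀ n j → ℕ→ℚ (n C j) * monomialIntegral j ≡ ℕ→ℚ (suc n C suc j) * monomialIntegral n
C-*-monomialIntegral n j = begin
  ℕ→ℚ (n C j) * (ℤ.+ 1 / suc j)                    ≡⟨ /-* (n C j) 1 1 (suc j) ⟩
  ℤ.+ ((n C j) ℕ.* 1) / (1 ℕ.* suc j)              ≡⟨ /-cross ((n C j) ℕ.* 1) (1 ℕ.* suc j) ((suc n C suc j) ℕ.* 1) (1 ℕ.* suc n) cross ⟩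
  ℤ.+ ((suc n C suc j) ℕ.* 1) / (1 ℕ.* suc n)      ≡⟨ /-* (suc n C suc j) 1 1 (suc n) ⟨
  ℕ→ℚ (suc n C suc j) * (ℤ.+ 1 / suc n)            ∎
  where
  normalise : ∀ c m → c ℕ.* 1 ℕ.* (1 ℕ.* m) ≡ m ℕ.* c
  normalise = ℕ-RingSolver.solve-∀
  cross : (n C j) ℕ.* 1 ℕ.* (1 ℕ.* suc n) ≡ (suc n C suc j) ℕ.* 1 ℕ.* (1 ℕ.* suc j)
  cross = trans (normalise (n C j) (suc n))
         (trans (sym (suc-*-C-suc n j)) (sym (normalise (suc n C suc j) (suc j))))

-- ∫₀¹ B_{m+1}(x) dx = 0
bernoulliPoly-integral : ∀ m → Σ< (suc (suc m)) (λ j → bernoulliCoefficient (suc m) j * monomialIntegral j) ≡ 0ℚ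
bernoulliPoly-integral m = begin
  Σ< (suc n) (λ j → bernoulliCoefficient n j * monomialIntegral j) ≡⟨ Σ<-cong (suc n) (λ j _ → term j) ⟩
  Σ< (suc n) (λ j → h * g j)                                     ≡⟨ Σ<-*ˡ (suc n) h g ⟩
  h * Σ< (suc n) g                                               ≡⟨ cong (h *_) (Σ<-reverse n g) ⟩
  h * Σ< (suc n) (λ k → g (n ∸ k))                               ≡⟨ cong (h *_) (Σ<-cong (suc n) (λ k k<n → reverse k (ℕₚ.≤-pred k<n))) ⟩
  h * Σ< (suc n) (λ k → ℕ→ℚ (suc n C k) * bernoulli k)           ≡⟨ cong (h *_) (bernoulli-binomialSum m) ⟩
  h * 0ℚ                                                         ≡⟨ ℚₚ.*-zeroʳ h ⟩
  0ℚ                                                             ∎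
  where
  n = suc m
  h = monomialIntegral n
  g : ℕ → ℚ
  g j = ℕ→ℚ (suc n C suc j) * bernoulli (n ∸ j)
  swap : ∀ c b i → c * b * i ≡ (c * i) * b
  swap = solve 3 (λ c b i → c :* b :* i := (c :* i) :* b) refl
  move : ∀ c h b → (c * h) * b ≡ h * (c * b)
  move = solve 3 (λ c h b → (c :* h) :* b := h :* (c :* b)) refl
  term : ∀ j → bernoulliCoefficient n j * monomialIntegral j ≡ h * g j
  term j = begin
    ℕ→ℚ (n C j) * bernoulli (n ∸ j) * monomialIntegral j       ≡⟨ swap (ℕ→ℚ (n C j)) (bernoulli (n ∸ j)) (monomialIntegral j) ⟩
    (ℕ→ℚ (n C j) * monomialIntegral j) * bernoulli (n ∸ j)     ≡⟨ cong (_* bernoulli (n ∸ j)) (C-*-monomialIntegral n j) ⟩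
    (ℕ→ℚ (suc n C suc j) * h) * bernoulli (n ∸ j)              ≡⟨ move (ℕ→ℚ (suc n C suc j)) h (bernoulli (n ∸ j)) ⟩
    h * g j                                                     ∎
  reverse : ∀ k → k ≤ n → g (n ∸ k) ≡ ℕ→ℚ (suc n C k) * bernoulli k
  reverse k k≤n = cong₂ (λ c i → ℕ→ℚ c * bernoulli i)
    (trans (cong (suc n C_) (sym (ℕₚ.+-∸-assoc 1 k≤n))) (sym (nCk≡nC[n∸k] (ℕₚ.m≤n⇒m≤1+n k≤n))))
    (ℕₚ.m∸[m∸n]≡n k≤n)

prodFin-monomialIntegral : ∀ D → prodFin D (monomialIntegral ∘ toℕ) ≡ inv! D
prodFin-monomialIntegral zero    = refl
prodFin-monomialIntegral (suc D) = begin
  prodFin (suc D) (monomialIntegral ∘ toℕ)                        ≡⟨ prodFin-snoc D monomialIntegral ⟩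
  prodFin D (monomialIntegral ∘ toℕ) * monomialIntegral D         ≡⟨ cong (_* monomialIntegral D) (prodFin-monomialIntegral D) ⟩
  inv! D * monomialIntegral D                                     ≡⟨ inv!-suc D ⟩
  inv! (suc D)                                                    ∎

sumFin-bernoulliCoefficient : ∀ D (r : Fin D) (h : ℕ → ℚ) →
  sumFin (suc D) (λ j → bernoulliCoefficient (suc (toℕ r)) (toℕ j) * h (toℕ j)) ≡
  Σ< (suc (suc (toℕ r))) (λ j → bernoulliCoefficient (suc (toℕ r)) j * h j)
sumFin-bernoulliCoefficient D r h = begin
  sumFin (suc D) (g ∘ toℕ)     ≡⟨ Σ<≡sumFin (suc D) g ⟨
  Σ< (suc D) g                 ≡⟨ cong (λ n → Σ< n g) D+1≡ ⟩
  Σ< (d ℕ.+ suc (suc (toℕ r))) g ≡⟨ Σ<-vanishing (suc (suc (toℕ r))) d g g-vanishes ⟩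
  Σ< (suc (suc (toℕ r))) g     ∎
  where
  g : ℕ → ℚ
  g j = bernoulliCoefficient (suc (toℕ r)) j * h j
  d = D ∸ suc (toℕ r)
  D+1≡ : suc D ≡ d ℕ.+ suc (suc (toℕ r))
  D+1≡ = trans (cong suc (sym (ℕₚ.m∸n+n≡m (Finₚ.toℕ<n r)))) (sym (ℕₚ.+-suc d (suc (toℕ r))))
  g-vanishes : ∀ k → suc (suc (toℕ r)) ≤ k → g k ≡ 0ℚ
  g-vanishes k r+1<k = trans (cong (_* h k) (bernoulliCoefficient-upper _ k r+1<k)) (ℚₚ.*-zeroˡ (h k))

module _ (D : ℕ) (x : Fin D → ℚ) where
  private
    M : Matrix (suc D)
    M = borderedVandermonde D monomialIntegral x

    L : Matrix (suc D)
    L n j = bernoulliCoefficient (toℕ n) (toℕ j)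

    Q : Matrix (suc D)
    Q n c = sumFin (suc D) (λ j → L n j * M j c)

    Bern : Matrix D
    Bern i k = bernoulliPoly (suc (toℕ i)) (x k)

    det-Q : det (suc D) Q ≡ det D Bern
    det-Q = begin
      det (suc D) Q                                 ≡⟨ det-pivot D Q zero column₀≡0 ⟩
      1ℚ * Q zero zero * det D (minor Q zero)       ≡⟨ cong₂ (λ q d → 1ℚ * q * d) Q₀₀≡1 (det-cong D minor≡) ⟩
      1ℚ * 1ℚ * det D Bern                          ≡⟨ ℚₚ.*-identityˡ (det D Bern) ⟩
      det D Bern                                    ∎
      where
      column₀≡0 : ∀ r → Q (suc r) zero ≡ 0ℚ
      column₀≡0 r = trans (sumFin-bernoulliCoefficient D r monomialIntegral) (bernoulliPoly-integral (toℕ r))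
      Q₀₀≡1 : Q zero zero ≡ 1ℚ
      Q₀₀≡1 = begin
        L zero zero * 1ℚ + sumFin D (λ j → L zero (suc j) * M (suc j) zero)
          ≡⟨ cong₂ (λ l s → l * 1ℚ + s) (bernoulliCoefficient-diag 0)
               (sumFin-zero D (λ j → trans (cong (_* M (suc j) zero) (bernoulliCoefficient-upper 0 (suc (toℕ j)) (s≤s z≤n)))
                                           (ℚₚ.*-zeroˡ (M (suc j) zero)))) ⟩
        1ℚ * 1ℚ + 0ℚ ≡⟨⟩
        1ℚ ∎
      minor≡ : ∀ r c → minor Q zero r c ≡ Bern r c
      minor≡ r c = sumFin-bernoulliCoefficient D r (x c ^ℚ_)

  F1≡vandermonde*signedElementarySum :
    F1 D x ≡ vandermonde D x * signedElementarySum D x (λ m → inv! D * monomialIntegral m)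
  F1≡vandermonde*signedElementarySum = begin
    F1 D x                                             ≡⟨ det-cong D (λ i k → ℚₚ.*-comm (Bern i k) _) ⟩
    det D (λ i k → monomialIntegral (toℕ i) * Bern i k) ≡⟨ det-scaleRows D (monomialIntegral ∘ toℕ) Bern ⟩
    prodFin D (monomialIntegral ∘ toℕ) * det D Bern    ≡⟨ cong₂ _*_ (prodFin-monomialIntegral D) (sym det-Q) ⟩
    inv! D * det (suc D) Q                             ≡⟨ cong (inv! D *_) (det-unitriangular (suc D) L M L-upper L-diag) ⟩
    inv! D * det (suc D) M                             ≡⟨ cong (inv! D *_) (det-borderedVandermonde D monomialIntegral x) ⟩
    inv! D * (V * S monomialIntegral)                  ≡⟨ left-comm (inv! D) V (S monomialIntegral) ⟩
    V * (inv! D * S monomialIntegral)                  ≡⟨ cong (V *_) (signedElementarySum-scale D x (inv! D) monomialIntegral) ⟨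
    V * S (λ m → inv! D * monomialIntegral m)          ∎
    where
    V = vandermonde D x
    S = signedElementarySum D x
    L-upper : ∀ i j → toℕ i < toℕ j → L i j ≡ 0ℚ
    L-upper i j = bernoulliCoefficient-upper (toℕ i) (toℕ j)
    L-diag : ∀ i → L i i ≡ 1ℚ
    L-diag i = bernoulliCoefficient-diag (toℕ i)
    left-comm : ∀ a b c → a * (b * c) ≡ b * (a * c)
    left-comm = solve 3 (λ a b c → a :* (b :* c) := b :* (a :* c)) refl

prependExponent : ∀ {D} → ℕ → ℚ × Monomial D → ℚ × Monomial (suc D)
prependExponent a (c , e) = c , a ∷ e

signedElementaryPoly : (D : ℕ) → (ℕ → ℚ) → Poly D
signedElementaryPoly zero    s = (s 0 , []) ∷ []
signedElementaryPoly (suc D) s =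
  List.map (prependExponent 1) (signedElementaryPoly D s) ++
  List.map (prependExponent 0) (signedElementaryPoly D (λ m → - s (suc m)))

eval-++ : ∀ {D} (p q : Poly D) x → eval (p ++ q) x ≡ eval p x + eval q x
eval-++ []             q x = sym (ℚₚ.+-identityˡ (eval q x))
eval-++ ((c , e) ∷ p) q x = trans (cong (c * evalMono e x +_) (eval-++ p q x))
                                  (sym (ℚₚ.+-assoc (c * evalMono e x) (eval p x) (eval q x)))

eval-prependExponent₁ : ∀ {D} (p : Poly D) (x : Fin (suc D) → ℚ) →
  eval (List.map (prependExponent 1) p) x ≡ x zero * eval p (x ∘ suc)
eval-prependExponent₁ []             x = sym (ℚₚ.*-zeroʳ (x zero))
eval-prependExponent₁ ((c , e) ∷ p) x = begin
  c * ((x zero * 1ℚ) * evalMono e (x ∘ suc)) + eval (List.map (prependExponent 1) p) x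
    ≡⟨ cong (c * ((x zero * 1ℚ) * evalMono e (x ∘ suc)) +_) (eval-prependExponent₁ p x) ⟩
  c * ((x zero * 1ℚ) * evalMono e (x ∘ suc)) + x zero * eval p (x ∘ suc)
    ≡⟨ factor c (x zero) (evalMono e (x ∘ suc)) (eval p (x ∘ suc)) ⟩
  x zero * (c * evalMono e (x ∘ suc) + eval p (x ∘ suc)) ∎
  where
  factor : ∀ c a m r → c * ((a * 1ℚ) * m) + a * r ≡ a * (c * m + r)
  factor = solve 4 (λ c a m r → c :* ((a :* con 1ℚ) :* m) :+ a :* r := a :* (c :* m :+ r)) refl

eval-prependExponent₀ : ∀ {D} (p : Poly D) (x : Fin (suc D) → ℚ) →
  eval (List.map (prependExponent 0) p) x ≡ eval p (x ∘ suc)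
eval-prependExponent₀ []             x = refl
eval-prependExponent₀ ((c , e) ∷ p) x =
  cong₂ _+_ (cong (c *_) (ℚₚ.*-identityˡ (evalMono e (x ∘ suc)))) (eval-prependExponent₀ p x)

eval-signedElementaryPoly : ∀ D s x → eval (signedElementaryPoly D s) x ≡ signedElementarySum D x s
eval-signedElementaryPoly zero    s x = trans (ℚₚ.+-identityʳ (s 0 * 1ℚ)) (ℚₚ.*-identityʳ (s 0))
eval-signedElementaryPoly (suc D) s x = begin
  eval (signedElementaryPoly (suc D) s) x
    ≡⟨ eval-++ (List.map (prependExponent 1) (signedElementaryPoly D s)) _ x ⟩
  eval (List.map (prependExponent 1) (signedElementaryPoly D s)) x +
  eval (List.map (prependExponent 0) (signedElementaryPoly D s')) x
    ≡⟨ cong₂ _+_ (eval-prependExponent₁ (signedElementaryPoly D s) x)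
                 (eval-prependExponent₀ (signedElementaryPoly D s') x) ⟩
  x zero * eval (signedElementaryPoly D s) (x ∘ suc) + eval (signedElementaryPoly D s') (x ∘ suc)
    ≡⟨ cong₂ (λ u v → x zero * u + v) (eval-signedElementaryPoly D s (x ∘ suc))
                                      (eval-signedElementaryPoly D s' (x ∘ suc)) ⟩
  signedElementarySum (suc D) x s ∎
  where
  s' = λ m → - s (suc m)

coeff-++ : ∀ {D} (p q : Poly D) e → coeff (p ++ q) e ≡ coeff p e + coeff q e
coeff-++ []             q e = sym (ℚₚ.+-identityˡ (coeff q e))
coeff-++ ((c , m) ∷ p) q e with Vecₚ.≡-dec ℕ._≟_ m e
... | yes _ = trans (cong (c +_) (coeff-++ p q e)) (sym (ℚₚ.+-assoc c (coeff p e) (coeff q e)))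
... | no _  = coeff-++ p q e

coeff-head-≡ : ∀ {D} c (m : Monomial D) p e → m ≡ e → coeff ((c , m) ∷ p) e ≡ c + coeff p e
coeff-head-≡ c m p e m≡e with Vecₚ.≡-dec ℕ._≟_ m e
... | yes _   = refl
... | no m≢e  = ⊥-elim (m≢e m≡e)

coeff-head-≢ : ∀ {D} c (m : Monomial D) p e → m ≢ e → coeff ((c , m) ∷ p) e ≡ coeff p e
coeff-head-≢ c m p e m≢e with Vecₚ.≡-dec ℕ._≟_ m e
... | yes m≡e = ⊥-elim (m≢e m≡e)
... | no _    = refl

coeff-prependExponent-≡ : ∀ {D} a (p : Poly D) e → coeff (List.map (prependExponent a) p) (a ∷ e) ≡ coeff p e
coeff-prependExponent-≡ a []             e = refl
coeff-prependExponent-≡ a ((c , m) ∷ p) e = byCases (Vecₚ.≡-dec ℕ._≟_ m e)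
  where
  byCases : Dec (m ≡ e) → coeff (List.map (prependExponent a) ((c , m) ∷ p)) (a ∷ e) ≡ coeff ((c , m) ∷ p) e
  byCases (yes m≡e) = trans (coeff-head-≡ c (a ∷ m) _ (a ∷ e) (cong (a ∷_) m≡e))
                            (trans (cong (c +_) (coeff-prependExponent-≡ a p e)) (sym (coeff-head-≡ c m p e m≡e)))
  byCases (no m≢e)  = trans (coeff-head-≢ c (a ∷ m) _ (a ∷ e) (m≢e ∘ Vecₚ.∷-injectiveʳ))
                            (trans (coeff-prependExponent-≡ a p e) (sym (coeff-head-≢ c m p e m≢e)))

coeff-prependExponent-≢ : ∀ {D} a b (p : Poly D) e → a ≢ b → coeff (List.map (prependExponent a) p) (b ∷ e) ≡ 0ℚ
coeff-prependExponent-≢ a b []             e a≢b = refl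
coeff-prependExponent-≢ a b ((c , m) ∷ p) e a≢b =
  trans (coeff-head-≢ c (a ∷ m) _ (b ∷ e) (a≢b ∘ Vecₚ.∷-injectiveˡ)) (coeff-prependExponent-≢ a b p e a≢b)

signedElementaryCoeff : (D : ℕ) → (ℕ → ℚ) → Monomial D → ℚ
signedElementaryCoeff zero    s []                 = s 0
signedElementaryCoeff (suc D) s (zero ∷ e)         = signedElementaryCoeff D (λ m → - s (suc m)) e
signedElementaryCoeff (suc D) s (suc zero ∷ e)     = signedElementaryCoeff D s e
signedElementaryCoeff (suc D) s (suc (suc k) ∷ e)  = 0ℚ

coeff-signedElementaryPoly : ∀ D s e → coeff (signedElementaryPoly D s) e ≡ signedElementaryCoeff D s e
coeff-signedElementaryPoly zero    s [] = trans (coeff-head-≡ (s 0) [] [] [] refl) (ℚₚ.+-identityʳ (s 0))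
coeff-signedElementaryPoly (suc D) s (k ∷ e) =
  trans (coeff-++ (List.map (prependExponent 1) (signedElementaryPoly D s)) _ (k ∷ e)) (split k)
  where
  s' = λ m → - s (suc m)
  split : ∀ k → coeff (List.map (prependExponent 1) (signedElementaryPoly D s)) (k ∷ e) +
                coeff (List.map (prependExponent 0) (signedElementaryPoly D s')) (k ∷ e) ≡
                signedElementaryCoeff (suc D) s (k ∷ e)
  split zero          = trans (cong₂ _+_ (coeff-prependExponent-≢ 1 0 (signedElementaryPoly D s) e (λ ()))
                                         (trans (coeff-prependExponent-≡ 0 (signedElementaryPoly D s') e)
                                                (coeff-signedElementaryPoly D s' e)))
                              (ℚₚ.+-identityˡ _)
  split (suc zero)    = trans (cong₂ _+_ (trans (coeff-prependExponent-≡ 1 (signedElementaryPoly D s) e)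
                                                (coeff-signedElementaryPoly D s e))
                                         (coeff-prependExponent-≢ 0 1 (signedElementaryPoly D s') e (λ ())))
                              (ℚₚ.+-identityʳ _)
  split (suc (suc k)) = cong₂ _+_ (coeff-prependExponent-≢ 1 (suc (suc k)) (signedElementaryPoly D s) e (λ ()))
                                  (coeff-prependExponent-≢ 0 (suc (suc k)) (signedElementaryPoly D s') e (λ ()))

countBy : ∀ {D} → (ℕ → ℕ) → Monomial D → ℕ
countBy f e = sum (f ∘ lookup e)

countBy-permuteMono : ∀ {D} f (σ : Permutation′ D) (e : Monomial D) → countBy f (permuteMono σ e) ≡ countBy f e
countBy-permuteMono f σ e = begin
  sum (f ∘ lookup (tabulate (lookup e ∘ (σ ⟨$⟩ʳ_))))  ≡⟨ sum-cong-≗ (cong f ∘ Vecₚ.lookup∘tabulate (lookup e ∘ (σ ⟨$⟩ʳ_))) ⟩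
  sum (f ∘ lookup e ∘ (σ ⟨$⟩ʳ_))                      ≡⟨ sum-permute (f ∘ lookup e) σ ⟨
  sum (f ∘ lookup e)                                  ∎

zeroWeight : ℕ → ℕ
zeroWeight zero    = 1
zeroWeight (suc _) = 0

largeWeight : ℕ → ℕ
largeWeight (suc (suc _)) = 1
largeWeight _             = 0

-- The coefficient of xᵉ only depends on the number of zero exponents and on whether some
-- exponent exceeds 1; both counts are invariant under permuting the variables.
coeffFromCounts : (ℕ → ℚ) → ℕ → ℕ → ℚ
coeffFromCounts s zero    z = sign z * s z
coeffFromCounts s (suc _) z = 0ℚ

signedElementaryCoeff≡coeffFromCounts : ∀ D s (e : Monomial D) →
  signedElementaryCoeff D s e ≡ coeffFromCounts s (countBy largeWeight e) (countBy zeroWeight e)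
signedElementaryCoeff≡coeffFromCounts zero    s []                = sym (ℚₚ.*-identityˡ (s 0))
signedElementaryCoeff≡coeffFromCounts (suc D) s (zero ∷ e)        =
  trans (signedElementaryCoeff≡coeffFromCounts D (λ m → - s (suc m)) e) (shift (countBy largeWeight e))
  where
  z = countBy zeroWeight e
  shift : ∀ b → coeffFromCounts (λ m → - s (suc m)) b z ≡ coeffFromCounts s b (suc z)
  shift zero    = begin
    sign z * - s (suc z)      ≡⟨ ℚₚ.neg-distribʳ-* (sign z) (s (suc z)) ⟨
    - (sign z * s (suc z))    ≡⟨ ℚₚ.neg-distribˡ-* (sign z) (s (suc z)) ⟩
    - sign z * s (suc z)      ≡⟨ cong (_* s (suc z)) (sign-suc z) ⟨
    sign (suc z) * s (suc z)  ∎
  shift (suc b) = refl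
signedElementaryCoeff≡coeffFromCounts (suc D) s (suc zero ∷ e)    = signedElementaryCoeff≡coeffFromCounts D s e
signedElementaryCoeff≡coeffFromCounts (suc D) s (suc (suc k) ∷ e) = refl

signedElementaryCoeff-permuteMono : ∀ D s (σ : Permutation′ D) e →
  signedElementaryCoeff D s (permuteMono σ e) ≡ signedElementaryCoeff D s e
signedElementaryCoeff-permuteMono D s σ e = begin
  signedElementaryCoeff D s (permuteMono σ e)
    ≡⟨ signedElementaryCoeff≡coeffFromCounts D s (permuteMono σ e) ⟩
  coeffFromCounts s (countBy largeWeight (permuteMono σ e)) (countBy zeroWeight (permuteMono σ e))
    ≡⟨ cong₂ (coeffFromCounts s) (countBy-permuteMono largeWeight σ e) (countBy-permuteMono zeroWeight σ e) ⟩
  coeffFromCounts s (countBy largeWeight e) (countBy zeroWeight e)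
    ≡⟨ signedElementaryCoeff≡coeffFromCounts D s e ⟨
  signedElementaryCoeff D s e ∎

signedElementaryCoeff-degree : ∀ D s (e : Monomial D) → signedElementaryCoeff D s e ≢ 0ℚ → totalDeg e ≤ D
signedElementaryCoeff-degree zero    s []                c≢0 = z≤n
signedElementaryCoeff-degree (suc D) s (zero ∷ e)        c≢0 = ℕₚ.m≤n⇒m≤1+n (signedElementaryCoeff-degree D _ e c≢0)
signedElementaryCoeff-degree (suc D) s (suc zero ∷ e)    c≢0 = s≤s (signedElementaryCoeff-degree D s e c≢0)
signedElementaryCoeff-degree (suc D) s (suc (suc k) ∷ e) c≢0 = ⊥-elim (c≢0 refl)

signedElementaryCoeff-ones : ∀ D s → signedElementaryCoeff D s (Vec.replicate D 1) ≡ s 0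
signedElementaryCoeff-ones zero    s = refl
signedElementaryCoeff-ones (suc D) s = signedElementaryCoeff-ones D s

signedElementaryCoeff-top : ∀ D s (e : Monomial D) → e ≢ Vec.replicate D 1 → D ≤ totalDeg e →
                            signedElementaryCoeff D s e ≡ 0ℚ
signedElementaryCoeff-top zero    s []                e≢1 _   = ⊥-elim (e≢1 refl)
signedElementaryCoeff-top (suc D) s (zero ∷ e)        e≢1 D<e with signedElementaryCoeff D (λ m → - s (suc m)) e ℚₚ.≟ 0ℚ
... | yes c≡0 = c≡0
... | no c≢0  = ⊥-elim (ℕₚ.<⇒≱ D<e (signedElementaryCoeff-degree D _ e c≢0))
signedElementaryCoeff-top (suc D) s (suc zero ∷ e)    e≢1 D≤e = signedElementaryCoeff-top D s e (e≢1 ∘ cong (1 ∷_)) (ℕₚ.≤-pred D≤e)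
signedElementaryCoeff-top (suc D) s (suc (suc k) ∷ e) e≢1 D≤e = refl

totalDeg-ones : ∀ D → totalDeg (Vec.replicate D 1) ≡ D
totalDeg-ones zero    = refl
totalDeg-ones (suc D) = cong suc (totalDeg-ones D)

proposition3p3 : (D : ℕ) → 1 ≤ D →
    ∃[ G ] (IsSymmetric G × HasDegree G D
    × ((x : Fin D → ℚ) → F1 D x ≡ vandermonde D x * eval G x)
    × HasLeadingPart G (inv! D)
    × eval {D} G (λ _ → 0ℚ) ≡ sign D * inv! (suc D))
proposition3p3 D _ = G , symmetric , degree , factorisation , leadingPart , atZero
  where
  s : ℕ → ℚ
  s m = inv! D * monomialIntegral m

  G : Poly D
  G = signedElementaryPoly D s

  coeff-G : ∀ e → coeff G e ≡ signedElementaryCoeff D s e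
  coeff-G = coeff-signedElementaryPoly D s

  leadingCoeff : coeff G (Vec.replicate D 1) ≡ inv! D
  leadingCoeff = trans (coeff-G _) (trans (signedElementaryCoeff-ones D s) (ℚₚ.*-identityʳ (inv! D)))

  symmetric : IsSymmetric G
  symmetric σ e = trans (coeff-G (permuteMono σ e))
                        (trans (signedElementaryCoeff-permuteMono D s σ e) (sym (coeff-G e)))

  degree : HasDegree G D
  degree = (λ e c≢0 → signedElementaryCoeff-degree D s e (c≢0 ∘ trans (coeff-G e)))
         , Vec.replicate D 1 , totalDeg-ones D , inv!≢0 D ∘ trans (sym leadingCoeff)

  factorisation : (x : Fin D → ℚ) → F1 D x ≡ vandermonde D x * eval G x
  factorisation x = trans (F1≡vandermonde*signedElementarySum D x)
                          (cong (vandermonde D x *_) (sym (eval-signedElementaryPoly D s x)))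

  leadingPart : HasLeadingPart G (inv! D)
  leadingPart = leadingCoeff , λ e e≢ones D≤e → trans (coeff-G e) (signedElementaryCoeff-top D s e e≢ones D≤e)

  atZero : eval G (λ _ → 0ℚ) ≡ sign D * inv! (suc D)
  atZero = trans (eval-signedElementaryPoly D s (λ _ → 0ℚ))
                 (trans (signedElementarySum-atZero D s) (cong (sign D *_) (inv!-suc D)))
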